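{- Let $a,b$ be positive integers. Let $U_{n,\ell}^{(a,b)}$ be the total number of $\mathbf{u}$-steps at level $\ell+1$ over all colored $(a,b)$-Dyck paths of length $2n+2$. Then for all integers $n\ge\ell\ge 0$, $$U_{n,\ell}^{(a,b)}=\sum_{j=0}^{n-\ell}\binom{n-\ell}{j}\left\{\frac{2(\ell+1)(a-b)}{2n-j+2}\binom{2n-j+2}{n-\ell}+\frac{(2\ell+3)b}{2n-j+3}\binom{2n-j+3}{n-\ell}\right\}(a-b)^{j}b^{n-j},$$ with $U_{0,0}^{(a,b)}=a$. Moreover, $U_{n,\ell}^{(a,b)}$ is the $(n,\ell)$-entry of the Riordan array $\left(C(a,b;x)^2(a-b+bC(a,b;x)),\ bxC(a,b;x)^2\right)$, i.e. $U_{n,\ell}^{(a,b)}=[x^n]C(a,b;x)^2(a-b+bC(a,b;x))\left(bxC(a,b;x)^2\right)^{\ell}$.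
   Context: A Dyck path of length $2n$ is a lattice path from $(0,0)$ to $(2n,0)$ weakly above the $x$-axis with steps $\mathbf{u}=(1,1)$, $\mathbf{d}=(1,-1)$. A colored $(a,b)$-Dyck path is a Dyck path in which each $\mathbf{d}$-step that is part of a peak (i.e. immediately preceded by a $\mathbf{u}$-step) is colored with one of $a$ colors and every other $\mathbf{d}$-step is colored with one of $b$ colors. A step is at level $\ell$ if the ordinate of its endpoint is $\ell$. $C(a,b;x)=\frac{1-(a-b)x-\sqrt{(1-(a-b)x)^2-4bx}}{2bx}$ is the unique power series with $C=1+(a-b)xC+bxC^2$. A Riordan array $(d(x),h(x))$ has $(n,k)$-entry $[x^n]d(x)h(x)^k$. -}

module Defs where

open import Data.Nat as ℕ using (ℕ; zero; suc; _≡ᵇ_)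
open import Data.Nat.Combinatorics using (_C_)
open import Data.Integer as ℤ using (ℤ; +_)
open import Data.Rational as ℚ using (ℚ)
open import Data.Fin using (Fin)
open import Relation.Binary.PropositionalEquality using (_≡_)
open import Data.Bool using (Bool; true; false; if_then_else_)
open import Data.List using (List; []; _∷_; _++_; map; concatMap; allFin; upTo; foldr)

-- A step: an up step u, a down step colored with one of a colors
-- (intended for down steps that are part of a peak), or a down step
-- colored with one of b colors (intended for all other down steps).
data Step (a b : ℕ) : Set where
  up    : Step a b
  dPeak : Fin a → Step a b
  dOth  : Fin b → Step a b

alphabet : (a b : ℕ) → List (Step a b)
alphabet a b = up ∷ (map dPeak (allFin a) ++ map dOth (allFin b))

words : (a b : ℕ) → ℕ → List (List (Step a b))
words a b zero    = [] ∷ []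
words a b (suc m) = concatMap (λ s → map (s ∷_) (words a b m)) (alphabet a b)

-- valid h prevUp w : reading w starting at height h, where prevUp says
-- whether the previous step was an up step; the path must stay weakly
-- above the x-axis, end at height 0, and a down step carries an a-color
-- iff it is immediately preceded by an up step (i.e. is part of a peak).
valid : ∀ {a b} → ℕ → Bool → List (Step a b) → Bool
valid zero    _     []             = true
valid (suc h) _     []             = false
valid h       _     (up ∷ w)       = valid (suc h) true w
valid zero    _     (dPeak _ ∷ w)  = false
valid (suc h) true  (dPeak _ ∷ w)  = valid h false w
valid (suc h) false (dPeak _ ∷ w)  = false
valid zero    _     (dOth _ ∷ w)   = false
valid (suc h) true  (dOth _ ∷ w)   = false
valid (suc h) false (dOth _ ∷ w)   = valid h false w

isColoredDyck : ∀ {a b} → List (Step a b) → Bool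
isColoredDyck = valid 0 false

-- upsAtLevel L h w : number of u-steps of w (read from height h) at level L,
-- i.e. whose endpoint has ordinate L.
upsAtLevel : ∀ {a b} → ℕ → ℕ → List (Step a b) → ℕ
upsAtLevel L h []            = 0
upsAtLevel L h (up ∷ w)      = (if suc h ≡ᵇ L then 1 else 0) ℕ.+ upsAtLevel L (suc h) w
upsAtLevel L zero (dPeak _ ∷ w)    = upsAtLevel L zero w
upsAtLevel L (suc h) (dPeak _ ∷ w) = upsAtLevel L h w
upsAtLevel L zero (dOth _ ∷ w)     = upsAtLevel L zero w
upsAtLevel L (suc h) (dOth _ ∷ w)  = upsAtLevel L h w

sumℕ : List ℕ → ℕ
sumℕ = foldr ℕ._+_ 0

Ucount : (a b n ℓ : ℕ) → ℕ
Ucount a b n ℓ =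
  sumℕ (map (λ w → if isColoredDyck w then upsAtLevel (suc ℓ) 0 w else 0)
            (words a b (2 ℕ.* n ℕ.+ 2)))

sumℚ : List ℚ → ℚ
sumℚ = foldr ℚ._+_ ℚ.0ℚ

toℚ : ℤ → ℚ
toℚ z = z ℚ./ 1

-- summand for index j (2n-j+2 and 2n-j+3 are written as suc (suc (2n ∸ j))
-- and suc (suc (suc (2n ∸ j))); these agree since j ≤ n - ℓ ≤ n).
Uterm : (a b n ℓ j : ℕ) → ℚ
Uterm a b n ℓ j =
  ((((+ (2 ℕ.* (ℓ ℕ.+ 1))) ℤ.* (+ a ℤ.- + b) ℤ.* + (suc (suc (2 ℕ.* n ℕ.∸ j)) C (n ℕ.∸ ℓ)))
       ℚ./ suc (suc (2 ℕ.* n ℕ.∸ j)))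
   ℚ.+ (((+ (2 ℕ.* ℓ ℕ.+ 3)) ℤ.* + b ℤ.* + (suc (suc (suc (2 ℕ.* n ℕ.∸ j))) C (n ℕ.∸ ℓ)))
       ℚ./ suc (suc (suc (2 ℕ.* n ℕ.∸ j)))))
  ℚ.* toℚ (+ ((n ℕ.∸ ℓ) C j) ℤ.* ((+ a ℤ.- + b) ℤ.^ j) ℤ.* ((+ b) ℤ.^ (n ℕ.∸ j)))

Uformula : (a b n ℓ : ℕ) → ℚ
Uformula a b n ℓ = sumℚ (map (Uterm a b n ℓ) (upTo (suc (n ℕ.∸ ℓ))))

Series : Set
Series = ℕ → ℤ

sumℤ : List ℤ → ℤ
sumℤ = foldr ℤ._+_ (+ 0)

_⊕_ : Series → Series → Series
(f ⊕ g) n = f n ℤ.+ g n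

_⊛_ : Series → Series → Series
(f ⊛ g) n = sumℤ (map (λ i → f i ℤ.* g (n ℕ.∸ i)) (upTo (suc n)))

scale : ℤ → Series → Series
scale c f n = c ℤ.* f n

oneS : Series
oneS zero    = + 1
oneS (suc _) = + 0

xS : Series
xS 1 = + 1
xS _ = + 0

powS : Series → ℕ → Series
powS f zero    = oneS
powS f (suc k) = f ⊛ powS f k

-- C satisfies C = 1 + (a-b) x C + b x C^2 (coefficientwise); this
-- characterizes C(a,b;x) uniquely.
IsCatalanAB : (a b : ℕ) → Series → Set
IsCatalanAB a b C =
  ∀ n → C n ≡ (oneS ⊕ (scale (+ a ℤ.- + b) (xS ⊛ C) ⊕ scale (+ b) (xS ⊛ (C ⊛ C)))) n

riordanEntry : Series → Series → ℕ → ℕ → ℤ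
riordanEntry d h n k = (d ⊛ powS h k) n

riordanD : (a b : ℕ) → Series → Series
riordanD a b C = (C ⊛ C) ⊛ (scale (+ a ℤ.- + b) oneS ⊕ scale (+ b) C)

riordanH : (a b : ℕ) → Series → Series
riordanH a b C = scale (+ b) (xS ⊛ (C ⊛ C))

{-# OPTIONS --safe #-}
module Submission where

open import Defs
open import Data.Nat using (ℕ; _≤_)
open import Data.Integer using (+_)
open import Data.Rational using (_/_)
open import Data.Product using (_×_)
open import Relation.Binary.PropositionalEquality using (_≡_)

-- Write p = a − b and q = b, so that C = 1 + p x C + q x C². By induction on the length, splitting off the
-- last step, the coloured path prefixes of length m ending at height t are counted by [z^m] z^t C(z²)^(t+1);
-- splitting off the first step, the completions of a path from height h are counted by q^h z^h C(z²)^(h+1)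
-- (plus p q^(h-1) z^h C(z²)^h when the last step was an up step). Cutting a path of length 2n+2 at each up
-- step reaching level ℓ+1 expresses U_{n,ℓ} as the coefficient of z^(2n+1) in the product of these two
-- series, that is U_{n,ℓ} = q^ℓ [x^(n-ℓ)] (p C^(2ℓ+2) + q C^(2ℓ+3)), which is also the Riordan entry.
-- The closed formula then follows from [x^m] C^k = Σ_{u+f=m} (k/N) binom(N,m) binom(m,f) q^u p^f with
-- N = 2u+f+k: both sides satisfy the recursion [x^(m+1)] C^(k+1) = [x^(m+1)] C^k + p [x^m] C^(k+1) + q [x^m] C^(k+2).


module PowerSeries where
  open import Data.Nat as ℕ using (ℕ; zero; suc)
  import Data.Nat.Properties as ℕ
  open import Data.Integer as ℤ using (ℤ; +_; _+_; _*_)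
  import Data.Integer.Properties as ℤ
  open import Data.Integer.Tactic.RingSolver using (solve-∀)
  open import Data.List using (map; applyUpTo)
  open import Function using (id)
  open import Relation.Binary.PropositionalEquality
  import Relation.Binary.Reasoning.Setoid as SetoidReasoning

  module ≗-Reasoning = SetoidReasoning (ℕ →-setoid ℤ)

  sumTo : (ℕ → ℤ) → ℕ → ℤ
  sumTo φ zero    = + 0
  sumTo φ (suc k) = φ 0 + sumTo (λ i → φ (suc i)) k

  sumℤ-applyUpTo : ∀ (φ : ℕ → ℤ) ψ k → sumℤ (map φ (applyUpTo ψ k)) ≡ sumTo (λ i → φ (ψ i)) k
  sumℤ-applyUpTo φ ψ zero    = refl
  sumℤ-applyUpTo φ ψ (suc k) = cong (_+_ (φ (ψ 0))) (sumℤ-applyUpTo φ (λ i → ψ (suc i)) k)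

  sumTo-cong : ∀ {φ ψ} k → (∀ i → i ℕ.< k → φ i ≡ ψ i) → sumTo φ k ≡ sumTo ψ k
  sumTo-cong zero    e = refl
  sumTo-cong (suc k) e = cong₂ _+_ (e 0 (ℕ.s≤s ℕ.z≤n)) (sumTo-cong k (λ i i<k → e (suc i) (ℕ.s≤s i<k)))

  zeroS : Series
  zeroS _ = + 0

  tail : Series → Series
  tail f n = f (suc n)

  shift : Series → Series
  shift f zero    = + 0
  shift f (suc n) = f n

  -- The convolution ⊛ of Defs, recast by structural recursion so that its algebra can be proved by induction.
  infixl 30 _⋆_
  _⋆_ : Series → Series → Series
  (f ⋆ g) zero    = f 0 * g 0
  (f ⋆ g) (suc n) = f 0 * g (suc n) + (tail f ⋆ g) n

  ⋆-as-sumTo : ∀ f g n → (f ⋆ g) n ≡ sumTo (λ i → f i * g (n ℕ.∸ i)) (suc n)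
  ⋆-as-sumTo f g zero    = sym (ℤ.+-identityʳ _)
  ⋆-as-sumTo f g (suc n) = cong (_+_ (f 0 * g (suc n))) (⋆-as-sumTo (tail f) g n)

  ⊛≗⋆ : ∀ f g → f ⊛ g ≗ f ⋆ g
  ⊛≗⋆ f g n = trans (sumℤ-applyUpTo (λ i → f i * g (n ℕ.∸ i)) id (suc n)) (sym (⋆-as-sumTo f g n))

  ⊕-cong : ∀ {f f′ g g′} → f ≗ f′ → g ≗ g′ → f ⊕ g ≗ f′ ⊕ g′
  ⊕-cong e e′ n = cong₂ _+_ (e n) (e′ n)

  ⊕-congʳ : ∀ f {g g′} → g ≗ g′ → f ⊕ g ≗ f ⊕ g′
  ⊕-congʳ f e n = cong (_+_ (f n)) (e n)

  scale-cong : ∀ c {f g} → f ≗ g → scale c f ≗ scale c g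
  scale-cong c e n = cong (c *_) (e n)

  ⋆-cong : ∀ {f f′ g g′} → f ≗ f′ → g ≗ g′ → f ⋆ g ≗ f′ ⋆ g′
  ⋆-cong e e′ zero    = cong₂ _*_ (e 0) (e′ 0)
  ⋆-cong e e′ (suc n) = cong₂ _+_ (cong₂ _*_ (e 0) (e′ (suc n))) (⋆-cong (λ i → e (suc i)) e′ n)

  ⋆-congˡ : ∀ {f f′} g → f ≗ f′ → f ⋆ g ≗ f′ ⋆ g
  ⋆-congˡ g e = ⋆-cong e (λ _ → refl)

  ⋆-congʳ : ∀ f {g g′} → g ≗ g′ → f ⋆ g ≗ f ⋆ g′
  ⋆-congʳ f e = ⋆-cong (λ _ → refl) e

  ⋆-local : ∀ f f′ g g′ n → (∀ i → i ≤ n → f i ≡ f′ i) → (∀ i → i ≤ n → g i ≡ g′ i) →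
    (f ⋆ g) n ≡ (f′ ⋆ g′) n
  ⋆-local f f′ g g′ zero    ef eg = cong₂ _*_ (ef 0 ℕ.z≤n) (eg 0 ℕ.z≤n)
  ⋆-local f f′ g g′ (suc n) ef eg =
    cong₂ _+_ (cong₂ _*_ (ef 0 ℕ.z≤n) (eg (suc n) ℕ.≤-refl))
              (⋆-local (tail f) (tail f′) g g′ n (λ i i≤n → ef (suc i) (ℕ.s≤s i≤n))
                                                 (λ i i≤n → eg i (ℕ.m≤n⇒m≤1+n i≤n)))

  ⋆-zeroˡ : ∀ g → zeroS ⋆ g ≗ zeroS
  ⋆-zeroˡ g zero    = refl
  ⋆-zeroˡ g (suc n) = trans (ℤ.+-identityˡ _) (⋆-zeroˡ g n)

  ⋆-identityˡ : ∀ g → oneS ⋆ g ≗ g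
  ⋆-identityˡ g zero    = ℤ.*-identityˡ (g 0)
  ⋆-identityˡ g (suc n) = begin
    + 1 * g (suc n) + (zeroS ⋆ g) n ≡⟨ cong₂ _+_ (ℤ.*-identityˡ (g (suc n))) (⋆-zeroˡ g n) ⟩
    g (suc n) + + 0                 ≡⟨ ℤ.+-identityʳ (g (suc n)) ⟩
    g (suc n)                       ∎
    where open ≡-Reasoning

  ⋆-scaleˡ : ∀ c f g → scale c f ⋆ g ≗ scale c (f ⋆ g)
  ⋆-scaleˡ c f g zero    = ℤ.*-assoc c (f 0) (g 0)
  ⋆-scaleˡ c f g (suc n) rewrite ⋆-scaleˡ c (tail f) g n = lemma c (f 0) (g (suc n)) _
    where
    lemma : ∀ c x y z → c * x * y + c * z ≡ c * (x * y + z)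
    lemma = solve-∀

  ⋆-scaleʳ : ∀ c f g → f ⋆ scale c g ≗ scale c (f ⋆ g)
  ⋆-scaleʳ c f g zero    = lemma c (f 0) (g 0)
    where
    lemma : ∀ c x y → x * (c * y) ≡ c * (x * y)
    lemma = solve-∀
  ⋆-scaleʳ c f g (suc n) rewrite ⋆-scaleʳ c (tail f) g n = lemma c (f 0) (g (suc n)) _
    where
    lemma : ∀ c x y z → x * (c * y) + c * z ≡ c * (x * y + z)
    lemma = solve-∀

  ⋆-distribʳ-⊕ : ∀ f g h → (f ⊕ g) ⋆ h ≗ f ⋆ h ⊕ g ⋆ h
  ⋆-distribʳ-⊕ f g h zero    = ℤ.*-distribʳ-+ (h 0) (f 0) (g 0)
  ⋆-distribʳ-⊕ f g h (suc n) rewrite ⋆-distribʳ-⊕ (tail f) (tail g) h n =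
    lemma (f 0) (g 0) (h (suc n)) _ _
    where
    lemma : ∀ x y z u v → (x + y) * z + (u + v) ≡ x * z + u + (y * z + v)
    lemma = solve-∀

  ⋆-distribˡ-⊕ : ∀ f g h → f ⋆ (g ⊕ h) ≗ f ⋆ g ⊕ f ⋆ h
  ⋆-distribˡ-⊕ f g h zero    = ℤ.*-distribˡ-+ (f 0) (g 0) (h 0)
  ⋆-distribˡ-⊕ f g h (suc n) rewrite ⋆-distribˡ-⊕ (tail f) g h n =
    lemma (f 0) (g (suc n)) (h (suc n)) _ _
    where
    lemma : ∀ x y z u v → x * (y + z) + (u + v) ≡ x * y + u + (x * z + v)
    lemma = solve-∀

  ⋆-snoc : ∀ f g n → (f ⋆ g) (suc n) ≡ (f ⋆ tail g) n + f (suc n) * g 0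
  ⋆-snoc f g zero    = refl
  ⋆-snoc f g (suc n) rewrite ⋆-snoc (tail f) g n =
    sym (ℤ.+-assoc (f 0 * g (suc (suc n))) ((tail f ⋆ tail g) n) _)

  ⋆-comm : ∀ f g → f ⋆ g ≗ g ⋆ f
  ⋆-comm f g zero    = ℤ.*-comm (f 0) (g 0)
  ⋆-comm f g (suc n) rewrite ⋆-comm (tail f) g n | ⋆-snoc g f n =
    trans (ℤ.+-comm (f 0 * g (suc n)) _) (cong (_+_ ((g ⋆ tail f) n)) (ℤ.*-comm (f 0) (g (suc n))))

  ⋆-identityʳ : ∀ g → g ⋆ oneS ≗ g
  ⋆-identityʳ g n = trans (⋆-comm g oneS n) (⋆-identityˡ g n)

  ⋆-assoc : ∀ f g h → (f ⋆ g) ⋆ h ≗ f ⋆ (g ⋆ h)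
  ⋆-assoc f g h zero    = ℤ.*-assoc (f 0) (g 0) (h 0)
  ⋆-assoc f g h (suc n) = begin
    f 0 * g 0 * h (suc n) + (tail (f ⋆ g) ⋆ h) n
      ≡⟨ cong (_+_ (f 0 * g 0 * h (suc n))) tail-step ⟩
    f 0 * g 0 * h (suc n) + (f 0 * (tail g ⋆ h) n + (tail f ⋆ (g ⋆ h)) n)
      ≡⟨ lemma (f 0) (g 0) (h (suc n)) _ _ ⟩
    f 0 * (g 0 * h (suc n) + (tail g ⋆ h) n) + (tail f ⋆ (g ⋆ h)) n
      ∎
    where
    open ≡-Reasoning
    lemma : ∀ x y z u v → x * y * z + (x * u + v) ≡ x * (y * z + u) + v
    lemma = solve-∀
    -- tail (f ⋆ g) is definitionally f 0 · tail g + tail f ⋆ g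
    tail-step : (tail (f ⋆ g) ⋆ h) n ≡ f 0 * (tail g ⋆ h) n + (tail f ⋆ (g ⋆ h)) n
    tail-step = begin
      ((scale (f 0) (tail g) ⊕ tail f ⋆ g) ⋆ h) n
        ≡⟨ ⋆-distribʳ-⊕ (scale (f 0) (tail g)) (tail f ⋆ g) h n ⟩
      (scale (f 0) (tail g) ⋆ h) n + ((tail f ⋆ g) ⋆ h) n
        ≡⟨ cong₂ _+_ (⋆-scaleˡ (f 0) (tail g) h n) (⋆-assoc (tail f) g h n) ⟩
      f 0 * (tail g ⋆ h) n + (tail f ⋆ (g ⋆ h)) n
        ∎

  shift-⋆ˡ : ∀ f g → shift f ⋆ g ≗ shift (f ⋆ g)
  shift-⋆ˡ f g zero    = refl
  shift-⋆ˡ f g (suc n) = ℤ.+-identityˡ _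

  shift-cong : ∀ {f g} → f ≗ g → shift f ≗ shift g
  shift-cong e zero    = refl
  shift-cong e (suc n) = e n

  shift-⊕ : ∀ f g → shift (f ⊕ g) ≗ shift f ⊕ shift g
  shift-⊕ f g zero    = refl
  shift-⊕ f g (suc n) = refl

  shift-scale : ∀ c f → shift (scale c f) ≗ scale c (shift f)
  shift-scale c f zero    = sym (ℤ.*-zeroʳ c)
  shift-scale c f (suc n) = refl

  shift-⋆ʳ : ∀ f g → f ⋆ shift g ≗ shift (f ⋆ g)
  shift-⋆ʳ f g n = begin
    (f ⋆ shift g) n  ≡⟨ ⋆-comm f (shift g) n ⟩
    (shift g ⋆ f) n  ≡⟨ shift-⋆ˡ g f n ⟩
    shift (g ⋆ f) n  ≡⟨ shift-cong (⋆-comm g f) n ⟩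
    shift (f ⋆ g) n  ∎
    where open ≡-Reasoning

  xS⊛≗shift : ∀ g → xS ⊛ g ≗ shift g
  xS⊛≗shift g n = begin
    (xS ⊛ g) n          ≡⟨ ⊛≗⋆ xS g n ⟩
    (xS ⋆ g) n          ≡⟨ ⋆-congˡ g xS≗shift-one n ⟩
    (shift oneS ⋆ g) n  ≡⟨ shift-⋆ˡ oneS g n ⟩
    shift (oneS ⋆ g) n  ≡⟨ shift-cong (⋆-identityˡ g) n ⟩
    shift g n           ∎
    where
    open ≡-Reasoning
    xS≗shift-one : xS ≗ shift oneS
    xS≗shift-one zero          = refl
    xS≗shift-one (suc zero)    = refl
    xS≗shift-one (suc (suc n)) = refl

  shiftBy : ℕ → Series → Series
  shiftBy zero    f = f
  shiftBy (suc t) f = shift (shiftBy t f)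

  shiftBy-cong : ∀ t {f g} → f ≗ g → shiftBy t f ≗ shiftBy t g
  shiftBy-cong zero    e = e
  shiftBy-cong (suc t) e = shift-cong (shiftBy-cong t e)

  shiftBy-+ : ∀ t f i → shiftBy t f (t ℕ.+ i) ≡ f i
  shiftBy-+ zero    f i = refl
  shiftBy-+ (suc t) f i = shiftBy-+ t f i

  shiftBy-shift : ∀ t f → shiftBy t (shift f) ≗ shift (shiftBy t f)
  shiftBy-shift zero    f = λ _ → refl
  shiftBy-shift (suc t) f = shift-cong (shiftBy-shift t f)

  shiftBy-shift² : ∀ t f → shiftBy t (shift (shift f)) ≗ shift (shift (shiftBy t f))
  shiftBy-shift² t f n = trans (shiftBy-shift t (shift f) n) (shift-cong (shiftBy-shift t f) n)

  shiftBy-⊕ : ∀ t f g → shiftBy t (f ⊕ g) ≗ shiftBy t f ⊕ shiftBy t g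
  shiftBy-⊕ zero    f g n = refl
  shiftBy-⊕ (suc t) f g n = trans (shift-cong (shiftBy-⊕ t f g) n) (shift-⊕ (shiftBy t f) (shiftBy t g) n)

  shiftBy-scale : ∀ t c f → shiftBy t (scale c f) ≗ scale c (shiftBy t f)
  shiftBy-scale zero    c f n = refl
  shiftBy-scale (suc t) c f n = trans (shift-cong (shiftBy-scale t c f) n) (shift-scale c (shiftBy t f) n)

  shiftBy-⋆ˡ : ∀ t f g → shiftBy t f ⋆ g ≗ shiftBy t (f ⋆ g)
  shiftBy-⋆ˡ zero    f g n = refl
  shiftBy-⋆ˡ (suc t) f g n = trans (shift-⋆ˡ (shiftBy t f) g n) (shift-cong (shiftBy-⋆ˡ t f g) n)

  shiftBy-⋆ʳ : ∀ t f g → f ⋆ shiftBy t g ≗ shiftBy t (f ⋆ g)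
  shiftBy-⋆ʳ zero    f g n = refl
  shiftBy-⋆ʳ (suc t) f g n = trans (shift-⋆ʳ f (shiftBy t g) n) (shift-cong (shiftBy-⋆ʳ t f g) n)

  shiftBy-shiftBy : ∀ s t f → shiftBy s (shiftBy t f) ≗ shiftBy (s ℕ.+ t) f
  shiftBy-shiftBy zero    t f n = refl
  shiftBy-shiftBy (suc s) t f n = shift-cong (shiftBy-shiftBy s t f) n

  shiftBy-⋆ : ∀ s t f g → shiftBy s f ⋆ shiftBy t g ≗ shiftBy (s ℕ.+ t) (f ⋆ g)
  shiftBy-⋆ s t f g = begin
    shiftBy s f ⋆ shiftBy t g        ≈⟨ shiftBy-⋆ˡ s f (shiftBy t g) ⟩
    shiftBy s (f ⋆ shiftBy t g)      ≈⟨ shiftBy-cong s (shiftBy-⋆ʳ t f g) ⟩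
    shiftBy s (shiftBy t (f ⋆ g))    ≈⟨ shiftBy-shiftBy s t (f ⋆ g) ⟩
    shiftBy (s ℕ.+ t) (f ⋆ g)        ∎
    where open ≗-Reasoning

  atSquare : Series → Series
  atSquare f zero          = f 0
  atSquare f (suc zero)    = + 0
  atSquare f (suc (suc n)) = atSquare (tail f) n

  atSquare-cong : ∀ {f g} → f ≗ g → atSquare f ≗ atSquare g
  atSquare-cong e zero          = e 0
  atSquare-cong e (suc zero)    = refl
  atSquare-cong e (suc (suc n)) = atSquare-cong (λ i → e (suc i)) n

  atSquare-+ : ∀ f m → atSquare f (m ℕ.+ m) ≡ f m
  atSquare-+ f zero    = refl
  atSquare-+ f (suc m) rewrite ℕ.+-suc m m = atSquare-+ (tail f) m

  atSquare-⊕ : ∀ f g → atSquare (f ⊕ g) ≗ atSquare f ⊕ atSquare g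
  atSquare-⊕ f g zero          = refl
  atSquare-⊕ f g (suc zero)    = refl
  atSquare-⊕ f g (suc (suc n)) = atSquare-⊕ (tail f) (tail g) n

  atSquare-scale : ∀ c f → atSquare (scale c f) ≗ scale c (atSquare f)
  atSquare-scale c f zero          = refl
  atSquare-scale c f (suc zero)    = sym (ℤ.*-zeroʳ c)
  atSquare-scale c f (suc (suc n)) = atSquare-scale c (tail f) n

  atSquare-zero : atSquare zeroS ≗ zeroS
  atSquare-zero zero          = refl
  atSquare-zero (suc zero)    = refl
  atSquare-zero (suc (suc n)) = atSquare-zero n

  atSquare-one : atSquare oneS ≗ oneS
  atSquare-one zero          = refl
  atSquare-one (suc zero)    = refl
  atSquare-one (suc (suc n)) = atSquare-zero n

  atSquare-shift : ∀ f → atSquare (shift f) ≗ shift (shift (atSquare f))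
  atSquare-shift f zero          = refl
  atSquare-shift f (suc zero)    = refl
  atSquare-shift f (suc (suc n)) = atSquare-cong (λ _ → refl) n

  atSquare-⋆ : ∀ f g → atSquare f ⋆ atSquare g ≗ atSquare (f ⋆ g)
  atSquare-⋆ f g zero          = refl
  atSquare-⋆ f g (suc zero)    = cong (_+ + 0) (ℤ.*-zeroʳ (f 0))
  atSquare-⋆ f g (suc (suc n)) = begin
    f 0 * atSquare (tail g) n + (+ 0 * atSquare g (suc n) + (atSquare (tail f) ⋆ atSquare g) n)
      ≡⟨ cong (_+_ (f 0 * atSquare (tail g) n)) (trans (ℤ.+-identityˡ _) (atSquare-⋆ (tail f) g n)) ⟩
    f 0 * atSquare (tail g) n + atSquare (tail f ⋆ g) n
      ≡⟨ cong (_+ atSquare (tail f ⋆ g) n) (sym (atSquare-scale (f 0) (tail g) n)) ⟩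
    atSquare (scale (f 0) (tail g)) n + atSquare (tail f ⋆ g) n
      ≡⟨ sym (atSquare-⊕ (scale (f 0) (tail g)) (tail f ⋆ g) n) ⟩
    atSquare (scale (f 0) (tail g) ⊕ tail f ⋆ g) n
      ∎
    where open ≡-Reasoning

  pow : Series → ℕ → Series
  pow f zero    = oneS
  pow f (suc k) = f ⋆ pow f k

  pow-+ : ∀ f i j → pow f i ⋆ pow f j ≗ pow f (i ℕ.+ j)
  pow-+ f zero    j n = ⋆-identityˡ (pow f j) n
  pow-+ f (suc i) j n = trans (⋆-assoc f (pow f i) (pow f j) n) (⋆-congʳ f (pow-+ f i j) n)

  shiftBy-atSquare-⋆ : ∀ s t f g m → (shiftBy s (atSquare f) ⋆ shiftBy t (atSquare g)) (s ℕ.+ t ℕ.+ (m ℕ.+ m)) ≡ (f ⋆ g) m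
  shiftBy-atSquare-⋆ s t f g m = begin
    (shiftBy s (atSquare f) ⋆ shiftBy t (atSquare g)) (s ℕ.+ t ℕ.+ (m ℕ.+ m))
      ≡⟨ shiftBy-⋆ s t (atSquare f) (atSquare g) _ ⟩
    shiftBy (s ℕ.+ t) (atSquare f ⋆ atSquare g) (s ℕ.+ t ℕ.+ (m ℕ.+ m))
      ≡⟨ shiftBy-+ (s ℕ.+ t) _ (m ℕ.+ m) ⟩
    (atSquare f ⋆ atSquare g) (m ℕ.+ m)
      ≡⟨ atSquare-⋆ f g (m ℕ.+ m) ⟩
    atSquare (f ⋆ g) (m ℕ.+ m)
      ≡⟨ atSquare-+ (f ⋆ g) m ⟩
    (f ⋆ g) m
      ∎
    where open ≡-Reasoning


module Weights (a b : ℕ) where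
  open import Data.Integer using (ℤ; _-_)

  p q : ℤ
  p = + a - + b
  q = + b


module CatalanPowers (a b : ℕ) (C : Series) (isC : IsCatalanAB a b C) where
  open PowerSeries
  open import Data.Nat as ℕ using (ℕ; zero; suc)
  import Data.Nat.Properties as ℕ
  open import Data.Integer as ℤ using (ℤ; +_; _+_; _*_; _^_)
  import Data.Integer.Properties as ℤ
  open import Relation.Binary.PropositionalEquality
  open Weights a b

  C-eqn : C ≗ oneS ⊕ (scale p (shift C) ⊕ scale q (shift (C ⋆ C)))
  C-eqn n = trans (isC n) (cong (_+_ (oneS n)) (cong₂ _+_
    (cong (p *_) (xS⊛≗shift C n))
    (cong (q *_) (trans (xS⊛≗shift (C ⊛ C) n) (shift-cong (⊛≗⋆ C C) n)))))

  P : ℕ → Series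
  P = pow C

  P-eqn : ∀ k → P (suc k) ≗ P k ⊕ (scale p (shift (P (suc k))) ⊕ scale q (shift (P (2 ℕ.+ k))))
  P-eqn k = begin
    C ⋆ P k
      ≈⟨ ⋆-congˡ (P k) C-eqn ⟩
    (oneS ⊕ (scale p (shift C) ⊕ scale q (shift (C ⋆ C)))) ⋆ P k
      ≈⟨ ⋆-distribʳ-⊕ oneS _ (P k) ⟩
    oneS ⋆ P k ⊕ (scale p (shift C) ⊕ scale q (shift (C ⋆ C))) ⋆ P k
      ≈⟨ ⊕-cong (⋆-identityˡ (P k)) (⋆-distribʳ-⊕ _ _ (P k)) ⟩
    P k ⊕ (scale p (shift C) ⋆ P k ⊕ scale q (shift (C ⋆ C)) ⋆ P k)
      ≈⟨ ⊕-congʳ (P k) (⊕-cong (⋆-scaleˡ p (shift C) (P k)) (⋆-scaleˡ q (shift (C ⋆ C)) (P k))) ⟩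
    P k ⊕ (scale p (shift C ⋆ P k) ⊕ scale q (shift (C ⋆ C) ⋆ P k))
      ≈⟨ ⊕-congʳ (P k) (⊕-cong (scale-cong p (shift-⋆ˡ C (P k)))
                                     (scale-cong q (λ n → trans (shift-⋆ˡ (C ⋆ C) (P k) n)
                                                                (shift-cong (⋆-assoc C C (P k)) n)))) ⟩
    P k ⊕ (scale p (shift (P (suc k))) ⊕ scale q (shift (P (2 ℕ.+ k))))
      ∎
    where open ≗-Reasoning

  P-zero : ∀ k → P k 0 ≡ + 1
  P-zero zero    = refl
  P-zero (suc k) = begin
    P (suc k) 0                ≡⟨ P-eqn k 0 ⟩
    P k 0 + (p * + 0 + q * + 0) ≡⟨ cong₂ (λ u v → P k 0 + (u + v)) (ℤ.*-zeroʳ p) (ℤ.*-zeroʳ q) ⟩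
    P k 0 + + 0                ≡⟨ trans (ℤ.+-identityʳ _) (P-zero k) ⟩
    + 1                        ∎
    where open ≡-Reasoning

  P-suc : ∀ k m → P (suc k) (suc m) ≡ P k (suc m) + (p * P (suc k) m + q * P (2 ℕ.+ k) m)
  P-suc k m = P-eqn k (suc m)

  G : ℕ → Series
  G t = shiftBy t (atSquare (P (suc t)))

  atSquare-P-eqn : ∀ k → atSquare (P (suc k)) ≗
    atSquare (P k) ⊕ (scale p (shift (shift (atSquare (P (suc k))))) ⊕ scale q (shift (shift (atSquare (P (2 ℕ.+ k))))))
  atSquare-P-eqn k = begin
    atSquare (P (suc k))
      ≈⟨ atSquare-cong (P-eqn k) ⟩
    atSquare (P k ⊕ (scale p (shift (P (suc k))) ⊕ scale q (shift (P (2 ℕ.+ k)))))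
      ≈⟨ atSquare-⊕ (P k) _ ⟩
    atSquare (P k) ⊕ atSquare (scale p (shift (P (suc k))) ⊕ scale q (shift (P (2 ℕ.+ k))))
      ≈⟨ ⊕-congʳ (atSquare (P k)) (atSquare-⊕ _ _) ⟩
    atSquare (P k) ⊕ (atSquare (scale p (shift (P (suc k)))) ⊕ atSquare (scale q (shift (P (2 ℕ.+ k)))))
      ≈⟨ ⊕-congʳ (atSquare (P k)) (⊕-cong (linear p (P (suc k))) (linear q (P (2 ℕ.+ k)))) ⟩
    atSquare (P k) ⊕ (scale p (shift (shift (atSquare (P (suc k))))) ⊕ scale q (shift (shift (atSquare (P (2 ℕ.+ k))))))
      ∎
    where
    open ≗-Reasoning
    linear : ∀ c f → atSquare (scale c (shift f)) ≗ scale c (shift (shift (atSquare f)))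
    linear c f n = trans (atSquare-scale c (shift f) n) (cong (c *_) (atSquare-shift f n))

  G-eqn-zero : G 0 ≗ oneS ⊕ (scale p (shift (shift (G 0))) ⊕ scale q (shift (G 1)))
  G-eqn-zero n = trans (atSquare-P-eqn 0 n) (cong (_+ (scale p (shift (shift (G 0))) ⊕ scale q (shift (G 1))) n) (atSquare-one n))

  G-eqn-suc : ∀ t → G (suc t) ≗ shift (G t) ⊕ (scale p (shift (shift (G (suc t)))) ⊕ scale q (shift (G (2 ℕ.+ t))))
  G-eqn-suc t = begin
    shiftBy (suc t) (atSquare (P (2 ℕ.+ t)))
      ≈⟨ shiftBy-cong (suc t) (atSquare-P-eqn (suc t)) ⟩
    shiftBy (suc t) (atSquare (P (suc t)) ⊕ (scale p (shift (shift Y)) ⊕ scale q (shift (shift Z))))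
      ≈⟨ shiftBy-⊕ (suc t) _ _ ⟩
    shift (G t) ⊕ shiftBy (suc t) (scale p (shift (shift Y)) ⊕ scale q (shift (shift Z)))
      ≈⟨ ⊕-congʳ (shift (G t)) (shiftBy-⊕ (suc t) _ _) ⟩
    shift (G t) ⊕ (shiftBy (suc t) (scale p (shift (shift Y))) ⊕ shiftBy (suc t) (scale q (shift (shift Z))))
      ≈⟨ ⊕-congʳ (shift (G t)) (⊕-cong (linear p Y) (linear q Z)) ⟩
    shift (G t) ⊕ (scale p (shift (shift (G (suc t)))) ⊕ scale q (shift (G (2 ℕ.+ t))))
      ∎
    where
    open ≗-Reasoning
    Y = atSquare (P (2 ℕ.+ t))
    Z = atSquare (P (3 ℕ.+ t))
    linear : ∀ c f → shiftBy (suc t) (scale c (shift (shift f))) ≗ scale c (shift (shift (shiftBy (suc t) f)))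
    linear c f n = trans (shiftBy-scale (suc t) c _ n) (cong (c *_) (shiftBy-shift² (suc t) f n))

  Uvalue : ℕ → ℕ → ℤ
  Uvalue ℓ m = q ^ ℓ * (p * P (2 ℕ.+ (ℓ ℕ.+ ℓ)) m + q * P (3 ℕ.+ (ℓ ℕ.+ ℓ)) m)

  C⋆C≗P2 : C ⋆ C ≗ P 2
  C⋆C≗P2 = ⋆-congʳ C (λ n → sym (⋆-identityʳ C n))

  riordanD≗ : riordanD a b C ≗ scale p (P 2) ⊕ scale q (P 3)
  riordanD≗ = begin
    (C ⊛ C) ⊛ (scale p oneS ⊕ scale q C)
      ≈⟨ ⊛≗⋆ (C ⊛ C) _ ⟩
    (C ⊛ C) ⋆ (scale p oneS ⊕ scale q C)
      ≈⟨ ⋆-congˡ _ (λ n → trans (⊛≗⋆ C C n) (C⋆C≗P2 n)) ⟩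
    P 2 ⋆ (scale p oneS ⊕ scale q C)
      ≈⟨ ⋆-distribˡ-⊕ (P 2) _ _ ⟩
    P 2 ⋆ scale p oneS ⊕ P 2 ⋆ scale q C
      ≈⟨ ⊕-cong (⋆-scaleʳ p (P 2) oneS) (⋆-scaleʳ q (P 2) C) ⟩
    scale p (P 2 ⋆ oneS) ⊕ scale q (P 2 ⋆ C)
      ≈⟨ ⊕-cong (scale-cong p (⋆-identityʳ (P 2))) (scale-cong q (⋆-comm (P 2) C)) ⟩
    scale p (P 2) ⊕ scale q (P 3)
      ∎
    where open ≗-Reasoning

  riordanH≗ : riordanH a b C ≗ scale q (shift (P 2))
  riordanH≗ = scale-cong q (λ n → trans (xS⊛≗shift (C ⊛ C) n) (shift-cong (λ i → trans (⊛≗⋆ C C i) (C⋆C≗P2 i)) n))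

  powS-riordanH : ∀ k → powS (riordanH a b C) k ≗ scale (q ^ k) (shiftBy k (P (k ℕ.+ k)))
  powS-riordanH zero    n = sym (ℤ.*-identityˡ (oneS n))
  powS-riordanH (suc k) n = begin
    (H ⊛ powS H k) n
      ≡⟨ ⊛≗⋆ H (powS H k) n ⟩
    (H ⋆ powS H k) n
      ≡⟨ ⋆-cong riordanH≗ (powS-riordanH k) n ⟩
    (scale q (shift (P 2)) ⋆ scale (q ^ k) (shiftBy k (P (k ℕ.+ k)))) n
      ≡⟨ ⋆-scaleˡ q (shift (P 2)) _ n ⟩
    q * (shift (P 2) ⋆ scale (q ^ k) (shiftBy k (P (k ℕ.+ k)))) n
      ≡⟨ cong (q *_) (⋆-scaleʳ (q ^ k) (shift (P 2)) _ n) ⟩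
    q * (q ^ k * (shiftBy 1 (P 2) ⋆ shiftBy k (P (k ℕ.+ k))) n)
      ≡⟨ cong (λ x → q * (q ^ k * x)) (shiftBy-⋆ 1 k (P 2) (P (k ℕ.+ k)) n) ⟩
    q * (q ^ k * shiftBy (suc k) (P 2 ⋆ P (k ℕ.+ k)) n)
      ≡⟨ cong (λ x → q * (q ^ k * x)) (shiftBy-cong (suc k) (pow-+ C 2 (k ℕ.+ k)) n) ⟩
    q * (q ^ k * shiftBy (suc k) (P (2 ℕ.+ (k ℕ.+ k))) n)
      ≡⟨ cong (λ j → q * (q ^ k * shiftBy (suc k) (P j) n)) (sym (ℕ.+-suc (suc k) k)) ⟩
    q * (q ^ k * shiftBy (suc k) (P (suc k ℕ.+ suc k)) n)
      ≡⟨ ℤ.*-assoc q (q ^ k) _ ⟨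
    q ^ suc k * shiftBy (suc k) (P (suc k ℕ.+ suc k)) n
      ∎
    where
    open ≡-Reasoning
    H = riordanH a b C

  riordanEntry[ℓ+m]≡Uvalue : ∀ ℓ m → riordanEntry (riordanD a b C) (riordanH a b C) (ℓ ℕ.+ m) ℓ ≡ Uvalue ℓ m
  riordanEntry[ℓ+m]≡Uvalue ℓ m = begin
    (riordanD a b C ⊛ powS (riordanH a b C) ℓ) (ℓ ℕ.+ m)
      ≡⟨ ⊛≗⋆ (riordanD a b C) _ (ℓ ℕ.+ m) ⟩
    (riordanD a b C ⋆ powS (riordanH a b C) ℓ) (ℓ ℕ.+ m)
      ≡⟨ ⋆-cong riordanD≗ (powS-riordanH ℓ) (ℓ ℕ.+ m) ⟩
    (D ⋆ scale (q ^ ℓ) (shiftBy ℓ (P (ℓ ℕ.+ ℓ)))) (ℓ ℕ.+ m)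
      ≡⟨ ⋆-scaleʳ (q ^ ℓ) D _ (ℓ ℕ.+ m) ⟩
    q ^ ℓ * (D ⋆ shiftBy ℓ (P (ℓ ℕ.+ ℓ))) (ℓ ℕ.+ m)
      ≡⟨ cong (q ^ ℓ *_) (trans (shiftBy-⋆ʳ ℓ D (P (ℓ ℕ.+ ℓ)) (ℓ ℕ.+ m)) (shiftBy-+ ℓ _ m)) ⟩
    q ^ ℓ * (D ⋆ P (ℓ ℕ.+ ℓ)) m
      ≡⟨ cong (q ^ ℓ *_) (⋆-distribʳ-⊕ (scale p (P 2)) (scale q (P 3)) (P (ℓ ℕ.+ ℓ)) m) ⟩
    q ^ ℓ * ((scale p (P 2) ⋆ P (ℓ ℕ.+ ℓ)) m + (scale q (P 3) ⋆ P (ℓ ℕ.+ ℓ)) m)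
      ≡⟨ cong (q ^ ℓ *_) (cong₂ _+_
           (trans (⋆-scaleˡ p (P 2) _ m) (cong (p *_) (pow-+ C 2 (ℓ ℕ.+ ℓ) m)))
           (trans (⋆-scaleˡ q (P 3) _ m) (cong (q *_) (pow-+ C 3 (ℓ ℕ.+ ℓ) m)))) ⟩
    Uvalue ℓ m
      ∎
    where
    open ≡-Reasoning
    D = scale p (P 2) ⊕ scale q (P 3)

  riordanEntry≡Uvalue : ∀ {n ℓ} → ℓ ℕ.≤ n → riordanEntry (riordanD a b C) (riordanH a b C) n ℓ ≡ Uvalue ℓ (n ℕ.∸ ℓ)
  riordanEntry≡Uvalue {n} {ℓ} ℓ≤n =
    subst (λ k → riordanEntry (riordanD a b C) (riordanH a b C) k ℓ ≡ Uvalue ℓ (n ℕ.∸ ℓ)) (ℕ.m+[n∸m]≡n ℓ≤n)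
          (riordanEntry[ℓ+m]≡Uvalue ℓ (n ℕ.∸ ℓ))


module ListSums where
  open import Data.Nat as ℕ using (ℕ; _+_; _*_)
  import Data.Nat.Properties as ℕ
  open import Data.Nat.ListAction.Properties using (sum-++)
  open import Data.Nat.Tactic.RingSolver using (solve-∀)
  open import Data.List using (List; []; _∷_; _++_; map; concatMap; allFin; length)
  import Data.List.Properties as List
  open import Data.Fin using (Fin)
  open import Function using (_∘_)
  open import Relation.Binary.PropositionalEquality

  module _ {A : Set} where

    sumℕ-map-cong : ∀ {f g : A → ℕ} xs → (∀ x → f x ≡ g x) → sumℕ (map f xs) ≡ sumℕ (map g xs)
    sumℕ-map-cong xs e = cong sumℕ (List.map-cong e xs)

    sumℕ-map-+ : ∀ (f g : A → ℕ) xs → sumℕ (map (λ x → f x + g x) xs) ≡ sumℕ (map f xs) + sumℕ (map g xs)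
    sumℕ-map-+ f g []       = refl
    sumℕ-map-+ f g (x ∷ xs) rewrite sumℕ-map-+ f g xs = lemma (f x) (g x) _ _
      where
      lemma : ∀ u v w z → u + v + (w + z) ≡ u + w + (v + z)
      lemma = solve-∀

    sumℕ-map-* : ∀ c (f : A → ℕ) xs → sumℕ (map (λ x → c * f x) xs) ≡ c * sumℕ (map f xs)
    sumℕ-map-* c f []       = sym (ℕ.*-zeroʳ c)
    sumℕ-map-* c f (x ∷ xs) rewrite sumℕ-map-* c f xs = sym (ℕ.*-distribˡ-+ c (f x) _)

    sumℕ-map-const : ∀ c (xs : List A) → sumℕ (map (λ _ → c) xs) ≡ length xs * c
    sumℕ-map-const c []       = refl
    sumℕ-map-const c (x ∷ xs) = cong (_+_ c) (sumℕ-map-const c xs)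

    sumℕ-map-zero : ∀ (xs : List A) → sumℕ (map (λ _ → 0) xs) ≡ 0
    sumℕ-map-zero xs = trans (sumℕ-map-const 0 xs) (ℕ.*-zeroʳ (length xs))

  sumℕ-map-∘ : ∀ {A B : Set} (g : B → ℕ) (f : A → B) xs → sumℕ (map g (map f xs)) ≡ sumℕ (map (g ∘ f) xs)
  sumℕ-map-∘ g f xs = cong sumℕ (sym (List.map-∘ xs))

  sumℕ-map-concatMap : ∀ {A B : Set} (g : B → ℕ) (h : A → List B) xs →
    sumℕ (map g (concatMap h xs)) ≡ sumℕ (map (λ x → sumℕ (map g (h x))) xs)
  sumℕ-map-concatMap g h []       = refl
  sumℕ-map-concatMap g h (x ∷ xs) = begin
    sumℕ (map g (h x ++ concatMap h xs))               ≡⟨ cong sumℕ (List.map-++ g (h x) (concatMap h xs)) ⟩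
    sumℕ (map g (h x) ++ map g (concatMap h xs))       ≡⟨ sum-++ (map g (h x)) _ ⟩
    sumℕ (map g (h x)) + sumℕ (map g (concatMap h xs)) ≡⟨ cong (_+_ (sumℕ (map g (h x)))) (sumℕ-map-concatMap g h xs) ⟩
    sumℕ (map g (h x)) + sumℕ (map (λ x → sumℕ (map g (h x))) xs) ∎
    where open ≡-Reasoning

  sumℕ-map-swap : ∀ {A B : Set} (f : A → B → ℕ) xs ys →
    sumℕ (map (λ x → sumℕ (map (f x) ys)) xs) ≡ sumℕ (map (λ y → sumℕ (map (λ x → f x y) xs)) ys)
  sumℕ-map-swap f []       ys = sym (sumℕ-map-zero ys)
  sumℕ-map-swap f (x ∷ xs) ys =
    trans (cong (_+_ (sumℕ (map (f x) ys))) (sumℕ-map-swap f xs ys))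
          (sym (sumℕ-map-+ (f x) (λ y → sumℕ (map (λ x → f x y) xs)) ys))

  sumℕ-allFin-const : ∀ n (f : Fin n → ℕ) c → (∀ i → f i ≡ c) → sumℕ (map f (allFin n)) ≡ n * c
  sumℕ-allFin-const n f c e = begin
    sumℕ (map f (allFin n))         ≡⟨ sumℕ-map-cong (allFin n) e ⟩
    sumℕ (map (λ _ → c) (allFin n)) ≡⟨ sumℕ-map-const c (allFin n) ⟩
    length (allFin n) * c           ≡⟨ cong (_* c) (List.length-tabulate {n = n} (λ i → i)) ⟩
    n * c                           ∎
    where open ≡-Reasoning


module ColouredWords (a b : ℕ) where
  open import Data.Nat using (ℕ; zero; suc; _+_; _*_)
  open import Data.Nat.ListAction.Properties using (sum-++)
  open import Data.List using (List; []; _∷_; _++_; map; allFin)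
  import Data.List.Properties as List
  open import Relation.Binary.PropositionalEquality
  open ListSums

  Word : Set
  Word = List (Step a b)

  sumWords : (Word → ℕ) → ℕ → ℕ
  sumWords g m = sumℕ (map g (words a b m))

  sumWords-cong : ∀ {g h} m → (∀ w → g w ≡ h w) → sumWords g m ≡ sumWords h m
  sumWords-cong m = sumℕ-map-cong (words a b m)

  sumWords-zero : ∀ m → sumWords (λ _ → 0) m ≡ 0
  sumWords-zero m = sumℕ-map-zero (words a b m)

  sumWords-+ : ∀ g h m → sumWords (λ w → g w + h w) m ≡ sumWords g m + sumWords h m
  sumWords-+ g h m = sumℕ-map-+ g h (words a b m)

  sumWords-* : ∀ c g m → sumWords (λ w → c * g w) m ≡ c * sumWords g m
  sumWords-* c g m = sumℕ-map-* c g (words a b m)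

  sumAlphabet : ∀ (F : Step a b → ℕ) cP cO → (∀ i → F (dPeak i) ≡ cP) → (∀ i → F (dOth i) ≡ cO) →
    sumℕ (map F (alphabet a b)) ≡ F up + (a * cP + b * cO)
  sumAlphabet F cP cO eP eO = cong (_+_ (F up)) (begin
    sumℕ (map F (map dPeak (allFin a) ++ map dOth (allFin b)))
      ≡⟨ cong sumℕ (List.map-++ F (map dPeak (allFin a)) (map dOth (allFin b))) ⟩
    sumℕ (map F (map dPeak (allFin a)) ++ map F (map dOth (allFin b)))
      ≡⟨ sum-++ (map F (map dPeak (allFin a))) _ ⟩
    sumℕ (map F (map dPeak (allFin a))) + sumℕ (map F (map dOth (allFin b)))
      ≡⟨ cong₂ _+_ (trans (sumℕ-map-∘ F dPeak (allFin a)) (sumℕ-allFin-const a _ cP eP))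
                   (trans (sumℕ-map-∘ F dOth (allFin b)) (sumℕ-allFin-const b _ cO eO)) ⟩
    a * cP + b * cO
      ∎)
    where open ≡-Reasoning

  sumWords-cons : ∀ g m → sumWords g (suc m) ≡ sumℕ (map (λ s → sumWords (λ w → g (s ∷ w)) m) (alphabet a b))
  sumWords-cons g m =
    trans (sumℕ-map-concatMap g (λ s → map (s ∷_) (words a b m)) (alphabet a b))
          (sumℕ-map-cong (alphabet a b) (λ s → sumℕ-map-∘ g (s ∷_) (words a b m)))

  sumWords-snoc : ∀ g m → sumWords g (suc m) ≡ sumℕ (map (λ s → sumWords (λ w → g (w ++ s ∷ [])) m) (alphabet a b))
  sumWords-snoc g zero    = sumWords-cons g zero
  sumWords-snoc g (suc m) = begin
    sumWords g (suc (suc m))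
      ≡⟨ sumWords-cons g (suc m) ⟩
    sumℕ (map (λ s → sumWords (λ w → g (s ∷ w)) (suc m)) A)
      ≡⟨ sumℕ-map-cong A (λ s → sumWords-snoc (λ w → g (s ∷ w)) m) ⟩
    sumℕ (map (λ s → sumℕ (map (λ s′ → sumWords (λ w → g (s ∷ w ++ s′ ∷ [])) m) A)) A)
      ≡⟨ sumℕ-map-swap (λ s s′ → sumWords (λ w → g (s ∷ w ++ s′ ∷ [])) m) A A ⟩
    sumℕ (map (λ s′ → sumℕ (map (λ s → sumWords (λ w → g (s ∷ w ++ s′ ∷ [])) m) A)) A)
      ≡⟨ sumℕ-map-cong A (λ s′ → sym (sumWords-cons (λ w → g (w ++ s′ ∷ [])) m)) ⟩
    sumℕ (map (λ s′ → sumWords (λ w → g (w ++ s′ ∷ [])) (suc m)) A)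
      ∎
    where
    open ≡-Reasoning
    A = alphabet a b

  sumWords-first : ∀ g gP gO m → (∀ i w → g (dPeak i ∷ w) ≡ gP w) → (∀ i w → g (dOth i ∷ w) ≡ gO w) →
    sumWords g (suc m) ≡ sumWords (λ w → g (up ∷ w)) m + (a * sumWords gP m + b * sumWords gO m)
  sumWords-first g gP gO m eP eO =
    trans (sumWords-cons g m)
          (sumAlphabet _ _ _ (λ i → sumWords-cong m (eP i)) (λ i → sumWords-cong m (eO i)))

  sumWords-last : ∀ g gP gO m → (∀ i w → g (w ++ dPeak i ∷ []) ≡ gP w) → (∀ i w → g (w ++ dOth i ∷ []) ≡ gO w) →
    sumWords g (suc m) ≡ sumWords (λ w → g (w ++ up ∷ [])) m + (a * sumWords gP m + b * sumWords gO m)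
  sumWords-last g gP gO m eP eO =
    trans (sumWords-snoc g m)
          (sumAlphabet _ _ _ (λ i → sumWords-cong m (eP i)) (λ i → sumWords-cong m (eO i)))


module PathCounts (a b : ℕ) where
  open import Data.Nat as ℕ using (ℕ; zero; suc; _+_; _*_; _≡ᵇ_)
  import Data.Nat.Properties as ℕ
  open import Data.Bool using (Bool; true; false; if_then_else_)
  open import Data.Bool.Properties using (if-eta)
  open import Data.List using ([]; _∷_; _++_)
  open import Relation.Binary.PropositionalEquality
  open ColouredWords a b

  colours : Bool → ℕ
  colours true  = a
  colours false = b

  sumWords-ground : ∀ g m → (∀ i w → g (dPeak i ∷ w) ≡ 0) → (∀ i w → g (dOth i ∷ w) ≡ 0) →
    sumWords g (suc m) ≡ sumWords (λ w → g (up ∷ w)) m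
  sumWords-ground g m eP eO = begin
    sumWords g (suc m)
      ≡⟨ sumWords-first g (λ _ → 0) (λ _ → 0) m eP eO ⟩
    sumWords (λ w → g (up ∷ w)) m + (a * sumWords (λ _ → 0) m + b * sumWords (λ _ → 0) m)
      ≡⟨ cong (λ z → sumWords (λ w → g (up ∷ w)) m + (a * z + b * z)) (sumWords-zero m) ⟩
    sumWords (λ w → g (up ∷ w)) m + (a * 0 + b * 0)
      ≡⟨ cong₂ (λ x y → sumWords (λ w → g (up ∷ w)) m + (x + y)) (ℕ.*-zeroʳ a) (ℕ.*-zeroʳ b) ⟩
    sumWords (λ w → g (up ∷ w)) m + 0
      ≡⟨ ℕ.+-identityʳ _ ⟩
    sumWords (λ w → g (up ∷ w)) m
      ∎
    where open ≡-Reasoning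

  -- A down step after an up step must take one of the a peak colours, otherwise one of the b others.
  sumWords-aloft : ∀ u g g′ m →
    (∀ i w → g (dPeak i ∷ w) ≡ (if u then g′ w else 0)) → (∀ i w → g (dOth i ∷ w) ≡ (if u then 0 else g′ w)) →
    sumWords g (suc m) ≡ sumWords (λ w → g (up ∷ w)) m + colours u * sumWords g′ m
  sumWords-aloft true g g′ m eP eO =
    trans (sumWords-first g g′ (λ _ → 0) m eP eO)
          (cong (λ z → sumWords (λ w → g (up ∷ w)) m + z)
                (trans (cong (λ z → a * sumWords g′ m + b * z) (sumWords-zero m))
                       (trans (cong (_+_ (a * sumWords g′ m)) (ℕ.*-zeroʳ b)) (ℕ.+-identityʳ _))))
  sumWords-aloft false g g′ m eP eO =
    trans (sumWords-first g (λ _ → 0) g′ m eP eO)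
          (cong (λ z → sumWords (λ w → g (up ∷ w)) m + (z + b * sumWords g′ m))
                (trans (cong (a *_) (sumWords-zero m)) (ℕ.*-zeroʳ a)))

  -- The state (h , u) is the current height and whether the last step was an up step.
  completes : ℕ → Bool → Word → ℕ
  completes h u w = if valid h u w then 1 else 0

  Completions : ℕ → Bool → ℕ → ℕ
  Completions h u = sumWords (completes h u)

  Completions-ground : ∀ u m → Completions 0 u (suc m) ≡ Completions 1 true m
  Completions-ground u m = sumWords-ground (completes 0 u) m (λ _ _ → refl) (λ _ _ → refl)

  Completions-aloft : ∀ h u m →
    Completions (suc h) u (suc m) ≡ Completions (2 + h) true m + colours u * Completions h false m
  Completions-aloft h true  m = sumWords-aloft true  (completes (suc h) true)  (completes h false) m (λ _ _ → refl) (λ _ _ → refl)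
  Completions-aloft h false m = sumWords-aloft false (completes (suc h) false) (completes h false) m (λ _ _ → refl) (λ _ _ → refl)

  upsIn : ℕ → ℕ → Bool → Word → ℕ
  upsIn L h u w = if valid h u w then upsAtLevel L h w else 0

  Ups : ℕ → ℕ → Bool → ℕ → ℕ
  Ups L h u = sumWords (upsIn L h u)

  valid-up : ∀ h u w → valid {a} {b} h u (up ∷ w) ≡ valid (suc h) true w
  valid-up zero    u w = refl
  valid-up (suc h) u w = refl

  reaches : ℕ → ℕ → ℕ
  reaches L h = if suc h ≡ᵇ L then 1 else 0

  upsIn-up : ∀ L h u w → upsIn L h u (up ∷ w) ≡ reaches L h * completes (suc h) true w + upsIn L (suc h) true w
  upsIn-up L h u w rewrite valid-up h u w with valid (suc h) true w
  ... | true  = cong (_+ upsAtLevel L (suc h) w) (sym (ℕ.*-identityʳ (reaches L h)))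
  ... | false = sym (trans (ℕ.+-identityʳ _) (ℕ.*-zeroʳ (reaches L h)))

  Ups-up : ∀ L h u m → sumWords (λ w → upsIn L h u (up ∷ w)) m ≡ reaches L h * Completions (suc h) true m + Ups L (suc h) true m
  Ups-up L h u m = begin
    sumWords (λ w → upsIn L h u (up ∷ w)) m
      ≡⟨ sumWords-cong m (upsIn-up L h u) ⟩
    sumWords (λ w → reaches L h * completes (suc h) true w + upsIn L (suc h) true w) m
      ≡⟨ sumWords-+ _ (upsIn L (suc h) true) m ⟩
    sumWords (λ w → reaches L h * completes (suc h) true w) m + Ups L (suc h) true m
      ≡⟨ cong (_+ Ups L (suc h) true m) (sumWords-* (reaches L h) (completes (suc h) true) m) ⟩
    reaches L h * Completions (suc h) true m + Ups L (suc h) true m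
      ∎
    where open ≡-Reasoning

  Ups-ground : ∀ L u m → Ups L 0 u (suc m) ≡ reaches L 0 * Completions 1 true m + Ups L 1 true m
  Ups-ground L u m = trans (sumWords-ground (upsIn L 0 u) m (λ _ _ → refl) (λ _ _ → refl)) (Ups-up L 0 u m)

  Ups-aloft : ∀ L h u m → Ups L (suc h) u (suc m) ≡
    reaches L (suc h) * Completions (2 + h) true m + Ups L (2 + h) true m + colours u * Ups L h false m
  Ups-aloft L h u m = trans (aloft u) (cong (_+ colours u * Ups L h false m) (Ups-up L (suc h) u m))
    where
    aloft : ∀ u → Ups L (suc h) u (suc m) ≡ sumWords (λ w → upsIn L (suc h) u (up ∷ w)) m + colours u * Ups L h false m
    aloft true  = sumWords-aloft true  (upsIn L (suc h) true)  (upsIn L h false) m (λ _ _ → refl) (λ _ _ → refl)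
    aloft false = sumWords-aloft false (upsIn L (suc h) false) (upsIn L h false) m (λ _ _ → refl) (λ _ _ → refl)

  Ups-empty : ∀ L h u → Ups L h u 0 ≡ 0
  Ups-empty L zero    u = refl
  Ups-empty L (suc h) u = refl

  sameFlag : Bool → Bool → ℕ
  sameFlag true  true  = 1
  sameFlag false false = 1
  sameFlag _     _     = 0

  endsAt : ℕ → Bool → Word → ℕ → Bool → ℕ
  endsAt h       u     []            t v = if h ≡ᵇ t then sameFlag u v else 0
  endsAt h       u     (up ∷ w)      t v = endsAt (suc h) true w t v
  endsAt zero    u     (dPeak _ ∷ w) t v = 0
  endsAt (suc h) true  (dPeak _ ∷ w) t v = endsAt h false w t v
  endsAt (suc h) false (dPeak _ ∷ w) t v = 0
  endsAt zero    u     (dOth _ ∷ w)  t v = 0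
  endsAt (suc h) true  (dOth _ ∷ w)  t v = 0
  endsAt (suc h) false (dOth _ ∷ w)  t v = endsAt h false w t v

  -- The end-state counts after one more step s, in terms of the end-state counts e before it.
  before : Step a b → (ℕ → Bool → ℕ) → ℕ → Bool → ℕ
  before up        e t       false = 0
  before up        e zero    true  = 0
  before up        e (suc t) true  = e t true + e t false
  before (dPeak _) e t       true  = 0
  before (dPeak _) e t       false = e (suc t) true
  before (dOth _)  e t       true  = 0
  before (dOth _)  e t       false = e (suc t) false

  before-zero : ∀ s t v → before s (λ _ _ → 0) t v ≡ 0
  before-zero up        t       false = refl
  before-zero up        zero    true  = refl
  before-zero up        (suc t) true  = refl
  before-zero (dPeak _) t       true  = refl
  before-zero (dPeak _) t       false = refl
  before-zero (dOth _)  t       true  = refl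
  before-zero (dOth _)  t       false = refl

  endsAt-single : ∀ h u s t v → endsAt h u (s ∷ []) t v ≡ before s (endsAt h u []) t v
  endsAt-single h       u     up        t       false = if-eta (suc h ≡ᵇ t)
  endsAt-single h       u     up        zero    true  = refl
  endsAt-single h       u     up        (suc t) true  with h ≡ᵇ t
  ... | true  = one-flag u
    where
    one-flag : ∀ u → 1 ≡ sameFlag u true + sameFlag u false
    one-flag true  = refl
    one-flag false = refl
  ... | false = refl
  endsAt-single zero    u     (dPeak _) t       true  = refl
  endsAt-single zero    u     (dPeak _) t       false = refl
  endsAt-single (suc h) true  (dPeak _) t       true  = if-eta (h ≡ᵇ t)
  endsAt-single (suc h) true  (dPeak _) t       false = refl
  endsAt-single (suc h) false (dPeak _) t       true  = refl
  endsAt-single (suc h) false (dPeak _) t       false = sym (if-eta (h ≡ᵇ t))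
  endsAt-single zero    u     (dOth _)  t       true  = refl
  endsAt-single zero    u     (dOth _)  t       false = refl
  endsAt-single (suc h) true  (dOth _)  t       true  = refl
  endsAt-single (suc h) true  (dOth _)  t       false = sym (if-eta (h ≡ᵇ t))
  endsAt-single (suc h) false (dOth _)  t       true  = if-eta (h ≡ᵇ t)
  endsAt-single (suc h) false (dOth _)  t       false = refl

  endsAt-snoc : ∀ h u w s t v → endsAt h u (w ++ s ∷ []) t v ≡ before s (endsAt h u w) t v
  endsAt-snoc h       u     []            s t v = endsAt-single h u s t v
  endsAt-snoc h       u     (up ∷ w)      s t v = endsAt-snoc (suc h) true w s t v
  endsAt-snoc zero    u     (dPeak _ ∷ w) s t v = sym (before-zero s t v)
  endsAt-snoc (suc h) true  (dPeak _ ∷ w) s t v = endsAt-snoc h false w s t v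
  endsAt-snoc (suc h) false (dPeak _ ∷ w) s t v = sym (before-zero s t v)
  endsAt-snoc zero    u     (dOth _ ∷ w)  s t v = sym (before-zero s t v)
  endsAt-snoc (suc h) true  (dOth _ ∷ w)  s t v = sym (before-zero s t v)
  endsAt-snoc (suc h) false (dOth _ ∷ w)  s t v = endsAt-snoc h false w s t v

  Prefixes : ℕ → Bool → ℕ → ℕ
  Prefixes t v = sumWords (λ w → endsAt 0 false w t v)

  no-down-steps : ∀ m → a * sumWords (λ _ → 0) m + b * sumWords (λ _ → 0) m ≡ 0
  no-down-steps m rewrite sumWords-zero m | ℕ.*-zeroʳ a | ℕ.*-zeroʳ b = refl

  Prefixes-last-up : ∀ t m → Prefixes (suc t) true (suc m) ≡ Prefixes t true m + Prefixes t false m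
  Prefixes-last-up t m = begin
    Prefixes (suc t) true (suc m)
      ≡⟨ sumWords-last g (λ _ → 0) (λ _ → 0) m (λ i w → endsAt-snoc 0 false w (dPeak i) (suc t) true)
                                                (λ i w → endsAt-snoc 0 false w (dOth i) (suc t) true) ⟩
    sumWords (λ w → g (w ++ up ∷ [])) m + (a * sumWords (λ _ → 0) m + b * sumWords (λ _ → 0) m)
      ≡⟨ cong₂ _+_ (sumWords-cong m (λ w → endsAt-snoc 0 false w up (suc t) true)) (no-down-steps m) ⟩
    sumWords (λ w → endsAt 0 false w t true + endsAt 0 false w t false) m + 0
      ≡⟨ trans (ℕ.+-identityʳ _) (sumWords-+ _ _ m) ⟩
    Prefixes t true m + Prefixes t false m
      ∎
    where
    open ≡-Reasoning
    g = λ w → endsAt 0 false w (suc t) true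

  Prefixes-ground-last-up : ∀ m → Prefixes 0 true (suc m) ≡ 0
  Prefixes-ground-last-up m = begin
    Prefixes 0 true (suc m)
      ≡⟨ sumWords-last g (λ _ → 0) (λ _ → 0) m (λ i w → endsAt-snoc 0 false w (dPeak i) 0 true)
                                                (λ i w → endsAt-snoc 0 false w (dOth i) 0 true) ⟩
    sumWords (λ w → g (w ++ up ∷ [])) m + (a * sumWords (λ _ → 0) m + b * sumWords (λ _ → 0) m)
      ≡⟨ cong₂ _+_ (trans (sumWords-cong m (λ w → endsAt-snoc 0 false w up 0 true)) (sumWords-zero m))
                   (no-down-steps m) ⟩
    0
      ∎
    where
    open ≡-Reasoning
    g = λ w → endsAt 0 false w 0 true

  Prefixes-last-down : ∀ t m → Prefixes t false (suc m) ≡ a * Prefixes (suc t) true m + b * Prefixes (suc t) false m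
  Prefixes-last-down t m = begin
    Prefixes t false (suc m)
      ≡⟨ sumWords-last g (λ w → endsAt 0 false w (suc t) true) (λ w → endsAt 0 false w (suc t) false) m
                       (λ i w → endsAt-snoc 0 false w (dPeak i) t false)
                       (λ i w → endsAt-snoc 0 false w (dOth i) t false) ⟩
    sumWords (λ w → g (w ++ up ∷ [])) m + (a * Prefixes (suc t) true m + b * Prefixes (suc t) false m)
      ≡⟨ cong (_+ (a * Prefixes (suc t) true m + b * Prefixes (suc t) false m))
              (trans (sumWords-cong m (λ w → endsAt-snoc 0 false w up t false)) (sumWords-zero m)) ⟩
    a * Prefixes (suc t) true m + b * Prefixes (suc t) false m
      ∎
    where
    open ≡-Reasoning
    g = λ w → endsAt 0 false w t false

  endsAtEither : ℕ → Bool → ℕ → Word → ℕ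
  endsAtEither h u t w = endsAt h u w t true + endsAt h u w t false

  Reach : ℕ → ℕ → Bool → ℕ → ℕ
  Reach t h u = sumWords (endsAtEither h u t)

  Reach-empty : ∀ t h u → Reach t h u 0 ≡ (if h ≡ᵇ t then 1 else 0)
  Reach-empty t h u with h ≡ᵇ t
  ... | false = refl
  ... | true  = one-flag u
    where
    one-flag : ∀ u → sameFlag u true + sameFlag u false + 0 ≡ 1
    one-flag true  = refl
    one-flag false = refl

  Reach-ground : ∀ t u m → Reach t 0 u (suc m) ≡ Reach t 1 true m
  Reach-ground t u m = sumWords-ground (endsAtEither 0 u t) m (λ _ _ → refl) (λ _ _ → refl)

  Reach-aloft : ∀ t h u m → Reach t (suc h) u (suc m) ≡ Reach t (2 + h) true m + colours u * Reach t h false m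
  Reach-aloft t h true  m = sumWords-aloft true  (endsAtEither (suc h) true t)  (endsAtEither h false t) m (λ _ _ → refl) (λ _ _ → refl)
  Reach-aloft t h false m = sumWords-aloft false (endsAtEither (suc h) false t) (endsAtEither h false t) m (λ _ _ → refl) (λ _ _ → refl)

  Reach-origin : ∀ t m → Reach t 0 false m ≡ Prefixes t true m + Prefixes t false m
  Reach-origin t m = sumWords-+ (λ w → endsAt 0 false w t true) (λ w → endsAt 0 false w t false) m


module Counting (a b : ℕ) (C : Series) (isC : IsCatalanAB a b C) where
  open PowerSeries
  open import Data.Nat as ℕ using (ℕ; zero; suc; _≡ᵇ_)
  import Data.Nat.Properties as ℕ
  open import Data.Integer as ℤ using (ℤ; +_; _+_; _*_; _-_; _^_)
  import Data.Integer.Properties as ℤ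
  open import Data.Integer.Tactic.RingSolver using (solve-∀)
  import Data.Nat.Tactic.RingSolver as NS
  open import Data.Bool using (Bool; true; false; T)
  open import Data.Unit using (tt)
  open import Relation.Binary.PropositionalEquality
  open Weights a b
  open CatalanPowers a b C isC
  open PathCounts a b

  pos-*+* : ∀ c x d y → + (c ℕ.* x ℕ.+ d ℕ.* y) ≡ + c * + x + + d * + y
  pos-*+* c x d y = trans (ℤ.pos-+ (c ℕ.* x) (d ℕ.* y)) (cong₂ _+_ (ℤ.pos-* c x) (ℤ.pos-* d y))

  G-zero-zero : G 0 0 ≡ + 1
  G-zero-zero = trans (G-eqn-zero 0) (cong₂ (λ x y → + 1 + (x + y)) (ℤ.*-zeroʳ p) (ℤ.*-zeroʳ q))

  G-suc-zero : ∀ t → G (suc t) 0 ≡ + 0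
  G-suc-zero t = trans (G-eqn-suc t 0) (cong₂ (λ x y → + 0 + (x + y)) (ℤ.*-zeroʳ p) (ℤ.*-zeroʳ q))

  lastUp : ℕ → Series
  lastUp zero    = zeroS
  lastUp (suc t) = shift (G t)

  lastDown : ℕ → Series
  lastDown zero    = oneS ⊕ (scale p (shift (shift (G 0))) ⊕ scale q (shift (G 1)))
  lastDown (suc t) = scale p (shift (shift (G (suc t)))) ⊕ scale q (shift (G (2 ℕ.+ t)))

  G-split : ∀ t → G t ≗ lastUp t ⊕ lastDown t
  G-split zero    n = trans (G-eqn-zero n) (sym (ℤ.+-identityˡ _))
  G-split (suc t) n = G-eqn-suc t n

  lastDown-suc : ∀ t m → lastDown t (suc m) ≡ p * shift (G t) m + q * G (suc t) m
  lastDown-suc zero    m = ℤ.+-identityˡ _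
  lastDown-suc (suc t) m = refl

  mutual
    Prefixes-lastUp : ∀ t m → + Prefixes t true m ≡ lastUp t m
    Prefixes-lastUp zero    zero    = refl
    Prefixes-lastUp (suc t) zero    = refl
    Prefixes-lastUp zero    (suc m) = cong +_ (Prefixes-ground-last-up m)
    Prefixes-lastUp (suc t) (suc m) = begin
      + Prefixes (suc t) true (suc m)                ≡⟨ cong +_ (Prefixes-last-up t m) ⟩
      + (Prefixes t true m ℕ.+ Prefixes t false m)   ≡⟨ ℤ.pos-+ (Prefixes t true m) _ ⟩
      + Prefixes t true m + + Prefixes t false m     ≡⟨ cong₂ _+_ (Prefixes-lastUp t m) (Prefixes-lastDown t m) ⟩
      lastUp t m + lastDown t m                      ≡⟨ G-split t m ⟨
      G t m                                          ∎
      where open ≡-Reasoning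

    Prefixes-lastDown : ∀ t m → + Prefixes t false m ≡ lastDown t m
    Prefixes-lastDown zero    zero    = sym (trans (cong₂ (λ x y → + 1 + (x + y)) (ℤ.*-zeroʳ p) (ℤ.*-zeroʳ q)) refl)
    Prefixes-lastDown (suc t) zero    = sym (cong₂ _+_ (ℤ.*-zeroʳ p) (ℤ.*-zeroʳ q))
    Prefixes-lastDown t       (suc m) = begin
      + Prefixes t false (suc m)
        ≡⟨ cong +_ (Prefixes-last-down t m) ⟩
      + (a ℕ.* Prefixes (suc t) true m ℕ.+ b ℕ.* Prefixes (suc t) false m)
        ≡⟨ pos-*+* a _ b _ ⟩
      + a * + Prefixes (suc t) true m + + b * + Prefixes (suc t) false m
        ≡⟨ cong₂ (λ x y → + a * x + + b * y) (Prefixes-lastUp (suc t) m) (Prefixes-lastDown (suc t) m) ⟩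
      + a * shift (G t) m + + b * lastDown (suc t) m
        ≡⟨ recolour (+ a) (+ b) _ _ ⟩
      p * shift (G t) m + q * (lastUp (suc t) m + lastDown (suc t) m)
        ≡⟨ cong (λ x → p * shift (G t) m + q * x) (G-split (suc t) m) ⟨
      p * shift (G t) m + q * G (suc t) m
        ≡⟨ lastDown-suc t m ⟨
      lastDown t (suc m)
        ∎
      where
      open ≡-Reasoning
      recolour : ∀ A B X Y → A * X + B * Y ≡ (A - B) * X + B * (X + Y)
      recolour = solve-∀

  mutual
    Completions-afterDown : ∀ m h → + Completions h false m ≡ q ^ h * G h m
    Completions-afterDown zero    zero    = sym (trans (ℤ.*-identityˡ _) G-zero-zero)
    Completions-afterDown zero    (suc h) = sym (trans (cong (q ^ suc h *_) (G-suc-zero h)) (ℤ.*-zeroʳ (q ^ suc h)))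
    Completions-afterDown (suc m) zero    = begin
      + Completions 0 false (suc m)
        ≡⟨ cong +_ (Completions-ground false m) ⟩
      + Completions 1 true m
        ≡⟨ Completions-afterUp m 0 ⟩
      q * + 1 * G 1 m + p * + 1 * shift (G 0) m
        ≡⟨ lemma p q (G 1 m) (shift (G 0) m) ⟩
      + 1 * (p * shift (G 0) m + q * G 1 m)
        ≡⟨ cong (+ 1 *_) (lastDown-suc 0 m) ⟨
      + 1 * lastDown 0 (suc m)
        ≡⟨ cong (+ 1 *_) (G-eqn-zero (suc m)) ⟨
      + 1 * G 0 (suc m)
        ∎
      where
      open ≡-Reasoning
      lemma : ∀ p q x y → q * + 1 * x + p * + 1 * y ≡ + 1 * (p * y + q * x)
      lemma = solve-∀
    Completions-afterDown (suc m) (suc h) = begin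
      + Completions (suc h) false (suc m)
        ≡⟨ cong +_ (Completions-aloft h false m) ⟩
      + (Completions (2 ℕ.+ h) true m ℕ.+ b ℕ.* Completions h false m)
        ≡⟨ ℤ.pos-+ _ (b ℕ.* Completions h false m) ⟩
      + Completions (2 ℕ.+ h) true m + + (b ℕ.* Completions h false m)
        ≡⟨ cong₂ _+_ (Completions-afterUp m (suc h))
                     (trans (ℤ.pos-* b _) (cong (q *_) (Completions-afterDown m h))) ⟩
      q * (q * q ^ h) * G (2 ℕ.+ h) m + p * (q * q ^ h) * shift (G (suc h)) m + q * (q ^ h * G h m)
        ≡⟨ lemma p q (q ^ h) (G h m) (shift (G (suc h)) m) (G (2 ℕ.+ h) m) ⟩
      q * q ^ h * (G h m + (p * shift (G (suc h)) m + q * G (2 ℕ.+ h) m))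
        ≡⟨ cong (q * q ^ h *_) (G-eqn-suc h (suc m)) ⟨
      q * q ^ h * G (suc h) (suc m)
        ∎
      where
      open ≡-Reasoning
      lemma : ∀ p q Q g₀ g₁ g₂ → q * (q * Q) * g₂ + p * (q * Q) * g₁ + q * (Q * g₀) ≡ q * Q * (g₀ + (p * g₁ + q * g₂))
      lemma = solve-∀

    Completions-afterUp : ∀ m h → + Completions (suc h) true m ≡ q ^ suc h * G (suc h) m + p * q ^ h * shift (G h) m
    Completions-afterUp zero h = sym (begin
      q ^ suc h * G (suc h) 0 + p * q ^ h * + 0 ≡⟨ cong₂ _+_ (cong (q ^ suc h *_) (G-suc-zero h)) (ℤ.*-zeroʳ (p * q ^ h)) ⟩
      q ^ suc h * + 0 + + 0                     ≡⟨ cong (_+ + 0) (ℤ.*-zeroʳ (q ^ suc h)) ⟩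
      + 0                                       ∎)
      where open ≡-Reasoning
    Completions-afterUp (suc m) h = begin
      + Completions (suc h) true (suc m)
        ≡⟨ cong +_ (Completions-aloft h true m) ⟩
      + (Completions (2 ℕ.+ h) true m ℕ.+ a ℕ.* Completions h false m)
        ≡⟨ ℤ.pos-+ _ (a ℕ.* Completions h false m) ⟩
      + Completions (2 ℕ.+ h) true m + + (a ℕ.* Completions h false m)
        ≡⟨ cong₂ _+_ (Completions-afterUp m (suc h))
                     (trans (ℤ.pos-* a _) (cong (+ a *_) (Completions-afterDown m h))) ⟩
      q * (q * q ^ h) * G (2 ℕ.+ h) m + p * (q * q ^ h) * shift (G (suc h)) m + + a * (q ^ h * G h m)
        ≡⟨ lemma (+ a) (+ b) (q ^ h) (G h m) (shift (G (suc h)) m) (G (2 ℕ.+ h) m) ⟩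
      q * q ^ h * (G h m + (p * shift (G (suc h)) m + q * G (2 ℕ.+ h) m)) + p * q ^ h * G h m
        ≡⟨ cong (λ x → q * q ^ h * x + p * q ^ h * G h m) (G-eqn-suc h (suc m)) ⟨
      q * q ^ h * G (suc h) (suc m) + p * q ^ h * G h m
        ∎
      where
      open ≡-Reasoning
      lemma : ∀ A B Q g₀ g₁ g₂ → B * (B * Q) * g₂ + (A - B) * (B * Q) * g₁ + A * (Q * g₀) ≡
                                 B * Q * (g₀ + ((A - B) * g₁ + B * g₂)) + (A - B) * Q * g₀
      lemma = solve-∀

  -- Cutting a path at each of its up steps ending at level ℓ + 1 turns the total count into a convolution
  -- of prefixes ending at height ℓ and completions from height ℓ + 1.
  module UpsAtLevel (ℓ : ℕ) where

    reach : ℕ → Bool → Series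
    reach h u i = + Reach ℓ h u i

    complete : Series
    complete i = + Completions (suc ℓ) true i

    reach-start : ∀ h u k → + reaches (suc ℓ) h * + Completions (suc h) true k ≡ reach h u 0 * complete k
    reach-start h u k rewrite Reach-empty ℓ h u with h ≡ᵇ ℓ in h≡ᵇℓ
    ... | true  = cong (λ j → + 1 * + Completions (suc j) true k) (ℕ.≡ᵇ⇒≡ h ℓ (subst T (sym h≡ᵇℓ) tt))
    ... | false = refl

    tail-reach-ground : ∀ u → tail (reach 0 u) ≗ reach 1 true
    tail-reach-ground u i = cong +_ (Reach-ground ℓ u i)

    tail-reach-aloft : ∀ h u → tail (reach (suc h) u) ≗ reach (2 ℕ.+ h) true ⊕ scale (+ colours u) (reach h false)
    tail-reach-aloft h u i = trans (cong +_ (Reach-aloft ℓ h u i))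
      (trans (ℤ.pos-+ (Reach ℓ (2 ℕ.+ h) true i) _) (cong (_+_ (reach (2 ℕ.+ h) true i)) (ℤ.pos-* (colours u) _)))

    Ups-one : ∀ h u → Ups (suc ℓ) h u 1 ≡ 0
    Ups-one zero    u = trans (Ups-ground (suc ℓ) u 0) (trans (ℕ.+-identityʳ _) (ℕ.*-zeroʳ (reaches (suc ℓ) 0)))
    Ups-one (suc h) u = trans (Ups-aloft (suc ℓ) h u 0)
      (cong₂ ℕ._+_ (trans (ℕ.+-identityʳ _) (ℕ.*-zeroʳ (reaches (suc ℓ) (suc h))))
                   (trans (cong (colours u ℕ.*_) (Ups-empty (suc ℓ) h false)) (ℕ.*-zeroʳ (colours u))))

    Ups-⋆ : ∀ m h u → + Ups (suc ℓ) h u (suc m) ≡ (reach h u ⋆ complete) m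
    Ups-⋆ zero    h       u = trans (cong +_ (Ups-one h u)) (sym (ℤ.*-zeroʳ (reach h u 0)))
    Ups-⋆ (suc m) zero    u = begin
      + Ups (suc ℓ) 0 u (2 ℕ.+ m)
        ≡⟨ cong +_ (Ups-ground (suc ℓ) u (suc m)) ⟩
      + (reaches (suc ℓ) 0 ℕ.* Completions 1 true (suc m) ℕ.+ Ups (suc ℓ) 1 true (suc m))
        ≡⟨ trans (ℤ.pos-+ _ (Ups (suc ℓ) 1 true (suc m)))
                 (cong (_+ + Ups (suc ℓ) 1 true (suc m)) (ℤ.pos-* (reaches (suc ℓ) 0) _)) ⟩
      + reaches (suc ℓ) 0 * + Completions 1 true (suc m) + + Ups (suc ℓ) 1 true (suc m)
        ≡⟨ cong₂ _+_ (reach-start 0 u (suc m)) (Ups-⋆ m 1 true) ⟩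
      reach 0 u 0 * complete (suc m) + (reach 1 true ⋆ complete) m
        ≡⟨ cong (_+_ (reach 0 u 0 * complete (suc m))) (⋆-congˡ complete (tail-reach-ground u) m) ⟨
      (reach 0 u ⋆ complete) (suc m)
        ∎
      where open ≡-Reasoning
    Ups-⋆ (suc m) (suc h) u = begin
      + Ups (suc ℓ) (suc h) u (2 ℕ.+ m)
        ≡⟨ cong +_ (Ups-aloft (suc ℓ) h u (suc m)) ⟩
      + (reaches (suc ℓ) (suc h) ℕ.* Completions (2 ℕ.+ h) true (suc m) ℕ.+ Ups (suc ℓ) (2 ℕ.+ h) true (suc m)
         ℕ.+ colours u ℕ.* Ups (suc ℓ) h false (suc m))
        ≡⟨ trans (ℤ.pos-+ _ (colours u ℕ.* Ups (suc ℓ) h false (suc m)))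
                 (cong₂ _+_ (trans (ℤ.pos-+ _ (Ups (suc ℓ) (2 ℕ.+ h) true (suc m)))
                                   (cong (_+ + Ups (suc ℓ) (2 ℕ.+ h) true (suc m)) (ℤ.pos-* (reaches (suc ℓ) (suc h)) _)))
                            (ℤ.pos-* (colours u) _)) ⟩
      + reaches (suc ℓ) (suc h) * + Completions (2 ℕ.+ h) true (suc m) + + Ups (suc ℓ) (2 ℕ.+ h) true (suc m)
        + + colours u * + Ups (suc ℓ) h false (suc m)
        ≡⟨ cong₂ _+_ (cong₂ _+_ (reach-start (suc h) u (suc m)) (Ups-⋆ m (2 ℕ.+ h) true))
                     (cong (+ colours u *_) (Ups-⋆ m h false)) ⟩
      reach (suc h) u 0 * complete (suc m) + (reach (2 ℕ.+ h) true ⋆ complete) m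
        + + colours u * (reach h false ⋆ complete) m
        ≡⟨ ℤ.+-assoc (reach (suc h) u 0 * complete (suc m)) _ _ ⟩
      reach (suc h) u 0 * complete (suc m) + ((reach (2 ℕ.+ h) true ⋆ complete) m
        + + colours u * (reach h false ⋆ complete) m)
        ≡⟨ cong (_+_ (reach (suc h) u 0 * complete (suc m))) (sym tail-step) ⟩
      (reach (suc h) u ⋆ complete) (suc m)
        ∎
      where
      open ≡-Reasoning
      tail-step : (tail (reach (suc h) u) ⋆ complete) m ≡
                  (reach (2 ℕ.+ h) true ⋆ complete) m + + colours u * (reach h false ⋆ complete) m
      tail-step = begin
        (tail (reach (suc h) u) ⋆ complete) m
          ≡⟨ ⋆-congˡ complete (tail-reach-aloft h u) m ⟩
        ((reach (2 ℕ.+ h) true ⊕ scale (+ colours u) (reach h false)) ⋆ complete) m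
          ≡⟨ ⋆-distribʳ-⊕ (reach (2 ℕ.+ h) true) _ complete m ⟩
        (reach (2 ℕ.+ h) true ⋆ complete) m + (scale (+ colours u) (reach h false) ⋆ complete) m
          ≡⟨ cong (_+_ ((reach (2 ℕ.+ h) true ⋆ complete) m)) (⋆-scaleˡ (+ colours u) (reach h false) complete m) ⟩
        (reach (2 ℕ.+ h) true ⋆ complete) m + + colours u * (reach h false ⋆ complete) m
          ∎

    reach-origin : reach 0 false ≗ G ℓ
    reach-origin i = begin
      + Reach ℓ 0 false i                          ≡⟨ cong +_ (Reach-origin ℓ i) ⟩
      + (Prefixes ℓ true i ℕ.+ Prefixes ℓ false i) ≡⟨ ℤ.pos-+ (Prefixes ℓ true i) _ ⟩
      + Prefixes ℓ true i + + Prefixes ℓ false i   ≡⟨ cong₂ _+_ (Prefixes-lastUp ℓ i) (Prefixes-lastDown ℓ i) ⟩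
      lastUp ℓ i + lastDown ℓ i                    ≡⟨ G-split ℓ i ⟨
      G ℓ i                                        ∎
      where open ≡-Reasoning

  Ucount[ℓ+m]≡Uvalue : ∀ ℓ m → + Ucount a b (ℓ ℕ.+ m) ℓ ≡ Uvalue ℓ m
  Ucount[ℓ+m]≡Uvalue ℓ m = begin
    + Ups (suc ℓ) 0 false (2 ℕ.* n ℕ.+ 2)
      ≡⟨ cong (λ k → + Ups (suc ℓ) 0 false k) (length-eq n) ⟩
    + Ups (suc ℓ) 0 false (suc N)
      ≡⟨ Ups-⋆ N 0 false ⟩
    (reach 0 false ⋆ complete) N
      ≡⟨ ⋆-cong reach-origin (λ i → Completions-afterUp i ℓ) N ⟩
    (G ℓ ⋆ (scale (q ^ suc ℓ) (G (suc ℓ)) ⊕ scale (p * q ^ ℓ) (shift (G ℓ)))) N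
      ≡⟨ ⋆-distribˡ-⊕ (G ℓ) _ _ N ⟩
    (G ℓ ⋆ scale (q ^ suc ℓ) (G (suc ℓ))) N + (G ℓ ⋆ scale (p * q ^ ℓ) (shift (G ℓ))) N
      ≡⟨ cong₂ _+_ (⋆-scaleʳ (q ^ suc ℓ) (G ℓ) _ N) (⋆-scaleʳ (p * q ^ ℓ) (G ℓ) _ N) ⟩
    q ^ suc ℓ * (G ℓ ⋆ G (suc ℓ)) N + p * q ^ ℓ * (G ℓ ⋆ shift (G ℓ)) N
      ≡⟨ cong₂ (λ x y → q ^ suc ℓ * x + p * q ^ ℓ * y) (G-⋆-G (suc (suc ℓ)) (3-eq ℓ)) (G-⋆-G (suc ℓ) (2-eq ℓ)) ⟩
    q ^ suc ℓ * P (3 ℕ.+ (ℓ ℕ.+ ℓ)) m + p * q ^ ℓ * P (2 ℕ.+ (ℓ ℕ.+ ℓ)) m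
      ≡⟨ lemma p q (q ^ ℓ) _ _ ⟩
    Uvalue ℓ m
      ∎
    where
    open ≡-Reasoning
    open UpsAtLevel ℓ
    n = ℓ ℕ.+ m
    N = suc (n ℕ.+ n)
    length-eq : ∀ n → 2 ℕ.* n ℕ.+ 2 ≡ suc (suc (n ℕ.+ n))
    length-eq = NS.solve-∀
    index-eq : ∀ ℓ m → suc ((ℓ ℕ.+ m) ℕ.+ (ℓ ℕ.+ m)) ≡ ℓ ℕ.+ suc ℓ ℕ.+ (m ℕ.+ m)
    index-eq = NS.solve-∀
    3-eq : ∀ ℓ → suc ℓ ℕ.+ suc (suc ℓ) ≡ 3 ℕ.+ (ℓ ℕ.+ ℓ)
    3-eq = NS.solve-∀
    2-eq : ∀ ℓ → suc ℓ ℕ.+ suc ℓ ≡ 2 ℕ.+ (ℓ ℕ.+ ℓ)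
    2-eq = NS.solve-∀
    -- Both G (suc ℓ) and shift (G ℓ) are definitionally of the form shiftBy (suc ℓ) (atSquare (P k)).
    G-⋆-G : ∀ k {j} → suc ℓ ℕ.+ k ≡ j → (G ℓ ⋆ shiftBy (suc ℓ) (atSquare (P k))) N ≡ P j m
    G-⋆-G k refl = trans (cong (G ℓ ⋆ shiftBy (suc ℓ) (atSquare (P k))) (index-eq ℓ m))
                         (trans (shiftBy-atSquare-⋆ ℓ (suc ℓ) (P (suc ℓ)) (P k) m) (pow-+ C (suc ℓ) k m))
    lemma : ∀ p q Q x₂ x₃ → q * Q * x₃ + p * Q * x₂ ≡ Q * (p * x₂ + q * x₃)
    lemma = solve-∀

  Ucount≡Uvalue : ∀ {n ℓ} → ℓ ℕ.≤ n → + Ucount a b n ℓ ≡ Uvalue ℓ (n ℕ.∸ ℓ)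
  Ucount≡Uvalue {n} {ℓ} ℓ≤n =
    subst (λ k → + Ucount a b k ℓ ≡ Uvalue ℓ (n ℕ.∸ ℓ)) (ℕ.m+[n∸m]≡n ℓ≤n) (Ucount[ℓ+m]≡Uvalue ℓ (n ℕ.∸ ℓ))


module LagrangeCoefficients where
  open import Data.Nat
  open import Data.Nat.Properties
  open import Data.Nat.Combinatorics using (_C_; nCk≡n!/k![n-k]!; k![n∸k]!∣n!)
  open import Data.Nat.DivMod using (m/n*n≡m)
  open import Data.Nat.Tactic.RingSolver using (solve-∀)
  open import Relation.Binary.PropositionalEquality

  -- M u f k is the coefficient of q^u p^f in [x^(u+f)] C^k; its clauses mirror
  -- [x^(m+1)] C^(k+1) = [x^(m+1)] C^k + p [x^m] C^(k+1) + q [x^m] C^(k+2).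
  M : ℕ → ℕ → ℕ → ℕ
  M zero    zero    k       = 1
  M zero    (suc f) zero    = 0
  M zero    (suc f) (suc k) = M zero (suc f) k + M zero f (suc k)
  M (suc u) zero    zero    = 0
  M (suc u) zero    (suc k) = M (suc u) zero k + M u zero (suc (suc k))
  M (suc u) (suc f) zero    = 0
  M (suc u) (suc f) (suc k) = M (suc u) (suc f) k + M (suc u) f (suc k) + M u (suc f) (suc (suc k))

  -- The two recursive terms of M u f (suc k) for (u , f) ≠ (0 , 0), coming from p x C^(k+1) and q x C^(k+2).
  viaP : ℕ → ℕ → ℕ → ℕ
  viaP u zero    k = 0
  viaP u (suc f) k = M u f (suc k)

  viaQ : ℕ → ℕ → ℕ → ℕ
  viaQ zero    f k = 0
  viaQ (suc u) f k = M u f (suc (suc k))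

  M-zero : ∀ m u f → u + f ≡ suc m → M u f 0 ≡ 0
  M-zero m zero    zero    ()
  M-zero m zero    (suc f) _ = refl
  M-zero m (suc u) zero    _ = refl
  M-zero m (suc u) (suc f) _ = refl

  M-suc : ∀ m u f k → u + f ≡ suc m → M u f (suc k) ≡ M u f k + viaP u f k + viaQ u f k
  M-suc m zero    zero    k ()
  M-suc m zero    (suc f) k _ = sym (+-identityʳ _)
  M-suc m (suc u) zero    k _ = cong (_+ M u zero (suc (suc k))) (sym (+-identityʳ _))
  M-suc m (suc u) (suc f) k _ = refl

  denominator : ℕ → ℕ → ℕ → ℕ
  denominator u f k = u ! * f ! * (u + k) !

  M-step : ∀ u f k N₀ N M₁ M₂ M₃ Z → .{{NonZero N₀}} → N₀ ≡ u + u + f + k → N ≡ suc N₀ →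
    M₁ * Z * N₀ ≡ (u + suc k) * k * N₀ ! → M₂ * Z * N₀ ≡ f * suc k * N₀ ! → M₃ * Z * N₀ ≡ u * suc (suc k) * N₀ ! →
    (M₁ + M₂ + M₃) * Z * N ≡ suc k * N !
  M-step u f k N₀ N M₁ M₂ M₃ Z eN₀ refl h₁ h₂ h₃ =
    trans (cong (_* suc N₀) (*-cancelʳ-≡ ((M₁ + M₂ + M₃) * Z) (suc k * N₀ !) N₀ sum-eq)) (rearrange k (N₀ !) N₀)
    where
    rearrange : ∀ k F N → suc k * F * suc N ≡ suc k * (F + N * F)
    rearrange = solve-∀
    distrib : ∀ M₁ M₂ M₃ Z N → (M₁ + M₂ + M₃) * Z * N ≡ M₁ * Z * N + M₂ * Z * N + M₃ * Z * N
    distrib = solve-∀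
    collect : ∀ u f k F → (u + suc k) * k * F + f * suc k * F + u * suc (suc k) * F ≡ suc k * F * (u + u + f + k)
    collect = solve-∀
    sum-eq : (M₁ + M₂ + M₃) * Z * N₀ ≡ suc k * N₀ ! * N₀
    sum-eq = trans (distrib M₁ M₂ M₃ Z N₀)
               (trans (cong₂ _+_ (cong₂ _+_ h₁ h₂) h₃) (trans (collect u f k (N₀ !)) (cong (suc k * N₀ ! *_) (sym eN₀))))

  -- Rescaling the induction hypotheses to the common denominator u! f! (u+k+1)! of M-step.
  scale-k : ∀ u f k M₁ N F → M₁ * denominator u f k * N ≡ k * F →
    M₁ * denominator u f (suc k) * N ≡ (u + suc k) * k * F
  scale-k u f k M₁ N F ih rewrite +-suc u k =
    trans (lemma (suc (u + k)) M₁ (u !) (f !) ((u + k) !) N) (trans (cong (suc (u + k) *_) ih) (sym (*-assoc (suc (u + k)) k F)))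
    where
    lemma : ∀ s M A B X N → M * (A * B * (s * X)) * N ≡ s * (M * (A * B * X) * N)
    lemma = solve-∀

  scale-f : ∀ u f k M₂ N F → M₂ * denominator u f (suc k) * N ≡ suc k * F →
    M₂ * denominator u (suc f) (suc k) * N ≡ suc f * suc k * F
  scale-f u f k M₂ N F ih =
    trans (lemma (suc f) M₂ (u !) (f !) ((u + suc k) !) N) (trans (cong (suc f *_) ih) (sym (*-assoc (suc f) (suc k) F)))
    where
    lemma : ∀ s M A B X N → M * (A * (s * B) * X) * N ≡ s * (M * (A * B * X) * N)
    lemma = solve-∀

  scale-u : ∀ u f k M₃ N F → M₃ * denominator u f (suc (suc k)) * N ≡ suc (suc k) * F →
    M₃ * denominator (suc u) f (suc k) * N ≡ suc u * suc (suc k) * F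
  scale-u u f k M₃ N F ih =
    trans (lemma (suc u) M₃ (u !) (f !) ((suc (u + suc k)) !) N)
      (trans (cong (suc u *_) (trans (cong (λ j → M₃ * (u ! * f ! * j !) * N) (sym (+-suc u (suc k)))) ih))
             (sym (*-assoc (suc u) (suc (suc k)) F)))
    where
    lemma : ∀ s M A B X N → M * ((s * A) * B * X) * N ≡ s * (M * (A * B * X) * N)
    lemma = solve-∀

  N-suc : ∀ u f k → u + u + f + suc k ≡ suc (u + u + f + k)
  N-suc = solve-∀

  N-f : ∀ u f k → u + u + f + suc k ≡ u + u + suc f + k
  N-f = solve-∀

  N-u : ∀ u f k → u + u + f + suc (suc k) ≡ suc u + suc u + f + k
  N-u = solve-∀

  M-factorials : ∀ u f k N → N ≡ u + u + f + k → M u f k * denominator u f k * N ≡ k * N !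
  M-factorials zero    zero    k       N refl = lemma k (k !)
    where
    lemma : ∀ k K → 1 * (1 * 1 * K) * k ≡ k * K
    lemma = solve-∀
  M-factorials zero    (suc f) zero    N _ = refl
  M-factorials (suc u) zero    zero    N _ = refl
  M-factorials (suc u) (suc f) zero    N _ = refl
  M-factorials zero    (suc f) (suc k) N e =
    trans (cong (λ x → x * denominator 0 (suc f) (suc k) * N) (sym (+-identityʳ (M 0 (suc f) k + M 0 f (suc k)))))
      (M-step 0 (suc f) k N₀ N (M 0 (suc f) k) (M 0 f (suc k)) 0 (denominator 0 (suc f) (suc k)) refl (trans e (N-suc 0 (suc f) k))
        (scale-k 0 (suc f) k (M 0 (suc f) k) N₀ (N₀ !) (M-factorials 0 (suc f) k N₀ refl))
        (scale-f 0 f k (M 0 f (suc k)) N₀ (N₀ !) (M-factorials 0 f (suc k) N₀ (sym (N-f 0 f k))))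
        refl)
    where N₀ = 0 + 0 + suc f + k
  M-factorials (suc u) zero    (suc k) N e =
    trans (cong (λ x → x * denominator (suc u) 0 (suc k) * N) (cong (_+ M u 0 (suc (suc k))) (sym (+-identityʳ (M (suc u) 0 k)))))
      (M-step (suc u) 0 k N₀ N (M (suc u) 0 k) 0 (M u 0 (suc (suc k))) (denominator (suc u) 0 (suc k)) refl (trans e (N-suc (suc u) 0 k))
        (scale-k (suc u) 0 k (M (suc u) 0 k) N₀ (N₀ !) (M-factorials (suc u) 0 k N₀ refl))
        refl
        (scale-u u 0 k (M u 0 (suc (suc k))) N₀ (N₀ !) (M-factorials u 0 (suc (suc k)) N₀ (sym (N-u u 0 k)))))
    where N₀ = suc u + suc u + 0 + k
  M-factorials (suc u) (suc f) (suc k) N e =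
    M-step (suc u) (suc f) k N₀ N (M (suc u) (suc f) k) (M (suc u) f (suc k)) (M u (suc f) (suc (suc k)))
      (denominator (suc u) (suc f) (suc k)) refl (trans e (N-suc (suc u) (suc f) k))
      (scale-k (suc u) (suc f) k (M (suc u) (suc f) k) N₀ (N₀ !) (M-factorials (suc u) (suc f) k N₀ refl))
      (scale-f (suc u) f k (M (suc u) f (suc k)) N₀ (N₀ !) (M-factorials (suc u) f (suc k) N₀ (sym (N-f (suc u) f k))))
      (scale-u u (suc f) k (M u (suc f) (suc (suc k))) N₀ (N₀ !) (M-factorials u (suc f) (suc (suc k)) N₀ (sym (N-u u (suc f) k))))
    where N₀ = suc u + suc u + suc f + k

  binomial-factorials : ∀ n k → k ≤ n → (n C k) * (k ! * (n ∸ k) !) ≡ n !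
  binomial-factorials n k k≤n =
    trans (cong (_* (k ! * (n ∸ k) !)) (nCk≡n!/k![n-k]! k≤n)) (m/n*n≡m {{k !* (n ∸ k) !≢0}} (k![n∸k]!∣n! k≤n))

  M-binomial : ∀ u f k N → N ≡ u + u + f + k → N * M u f k ≡ k * (N C (u + f)) * ((u + f) C f)
  M-binomial u f k N e = *-cancelʳ-≡ (N * M u f k) (k * A * B) (denominator u f k) {{denominator≢0}} (trans lhs (sym rhs))
    where
    m = u + f
    A = N C m
    B = m C f
    denominator≢0 : NonZero (denominator u f k)
    denominator≢0 = m*n≢0 (u ! * f !) ((u + k) !) {{m*n≢0 (u !) (f !) {{u !≢0}} {{f !≢0}}}} {{(u + k) !≢0}}
    N-split : N ≡ m + (u + k)
    N-split = trans e (regroup u f k)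
      where
      regroup : ∀ u f k → u + u + f + k ≡ (u + f) + (u + k)
      regroup = solve-∀
    lhs : N * M u f k * denominator u f k ≡ k * N !
    lhs = trans (lemma N (M u f k) (denominator u f k)) (M-factorials u f k N e)
      where
      lemma : ∀ N M Z → N * M * Z ≡ M * Z * N
      lemma = solve-∀
    A-factorials : A * (m ! * (u + k) !) ≡ N !
    A-factorials = subst (λ j → A * (m ! * j !) ≡ N !) (trans (cong (_∸ m) N-split) (m+n∸m≡n m (u + k)))
                     (binomial-factorials N m (subst (m ≤_) (sym N-split) (m≤m+n m (u + k))))
    B-factorials : B * (f ! * u !) ≡ m !
    B-factorials = subst (λ j → B * (f ! * j !) ≡ m !) (m+n∸n≡m u f) (binomial-factorials m f (m≤n+m f u))
    rhs : k * A * B * denominator u f k ≡ k * N !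
    rhs = begin
      k * A * B * (u ! * f ! * (u + k) !)    ≡⟨ lemma₁ k A B (u !) (f !) ((u + k) !) ⟩
      k * A * (B * (f ! * u !)) * (u + k) !  ≡⟨ cong (λ X → k * A * X * (u + k) !) B-factorials ⟩
      k * A * m ! * (u + k) !                ≡⟨ lemma₂ k A (m !) ((u + k) !) ⟩
      k * (A * (m ! * (u + k) !))            ≡⟨ cong (k *_) A-factorials ⟩
      k * N !                                ∎
      where
      open ≡-Reasoning
      lemma₁ : ∀ k A B U F K → k * A * B * (U * F * K) ≡ k * A * (B * (F * U)) * K
      lemma₁ = solve-∀
      lemma₂ : ∀ k A X K → k * A * X * K ≡ k * (A * (X * K))
      lemma₂ = solve-∀


module Antidiagonals where
  open PowerSeries
  open import Data.Nat as ℕ using (ℕ; zero; suc)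
  import Data.Nat.Properties as ℕ
  open import Data.Integer as ℤ using (ℤ; +_; _+_; _*_)
  import Data.Integer.Properties as ℤ
  open import Data.Integer.Tactic.RingSolver using (solve-∀)
  open import Relation.Binary.PropositionalEquality

  antidiagonal : (ℕ → ℕ → ℤ) → ℕ → ℤ
  antidiagonal g zero    = g 0 0
  antidiagonal g (suc m) = g (suc m) 0 + antidiagonal (λ u f → g u (suc f)) m

  antidiagonal-cong : ∀ {g h} m → (∀ u f → u ℕ.+ f ≡ m → g u f ≡ h u f) → antidiagonal g m ≡ antidiagonal h m
  antidiagonal-cong zero    e = e 0 0 refl
  antidiagonal-cong (suc m) e =
    cong₂ _+_ (e (suc m) 0 (ℕ.+-identityʳ (suc m)))
              (antidiagonal-cong m (λ u f u+f≡m → e u (suc f) (trans (ℕ.+-suc u f) (cong suc u+f≡m))))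

  antidiagonal-+ : ∀ g h m → antidiagonal (λ u f → g u f + h u f) m ≡ antidiagonal g m + antidiagonal h m
  antidiagonal-+ g h zero    = refl
  antidiagonal-+ g h (suc m) rewrite antidiagonal-+ (λ u f → g u (suc f)) (λ u f → h u (suc f)) m =
    lemma (g (suc m) 0) (h (suc m) 0) _ _
    where
    lemma : ∀ x y z w → x + y + (z + w) ≡ x + z + (y + w)
    lemma = solve-∀

  antidiagonal-scale : ∀ c g m → antidiagonal (λ u f → c * g u f) m ≡ c * antidiagonal g m
  antidiagonal-scale c g zero    = refl
  antidiagonal-scale c g (suc m) rewrite antidiagonal-scale c (λ u f → g u (suc f)) m =
    sym (ℤ.*-distribˡ-+ c (g (suc m) 0) _)

  antidiagonal-zero : ∀ g m → (∀ u f → u ℕ.+ f ≡ m → g u f ≡ + 0) → antidiagonal g m ≡ + 0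
  antidiagonal-zero g m e = trans (antidiagonal-cong m e) (zeros m)
    where
    zeros : ∀ m → antidiagonal (λ _ _ → + 0) m ≡ + 0
    zeros zero    = refl
    zeros (suc m) = trans (ℤ.+-identityˡ _) (zeros m)

  antidiagonal-suc-u : ∀ g m → (∀ f → g 0 f ≡ + 0) → antidiagonal g (suc m) ≡ antidiagonal (λ u f → g (suc u) f) m
  antidiagonal-suc-u g zero    e = trans (cong (_+_ (g 1 0)) (e 1)) (ℤ.+-identityʳ _)
  antidiagonal-suc-u g (suc m) e = cong (_+_ (g (2 ℕ.+ m) 0)) (antidiagonal-suc-u (λ u f → g u (suc f)) m (λ f → e (suc f)))

  antidiagonal-suc-f : ∀ g m → g (suc m) 0 ≡ + 0 → antidiagonal g (suc m) ≡ antidiagonal (λ u f → g u (suc f)) m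
  antidiagonal-suc-f g m e = trans (cong (_+ antidiagonal (λ u f → g u (suc f)) m) e) (ℤ.+-identityˡ _)

  antidiagonal-sumTo : ∀ g m → antidiagonal g m ≡ sumTo (λ f → g (m ℕ.∸ f) f) (suc m)
  antidiagonal-sumTo g zero    = sym (ℤ.+-identityʳ _)
  antidiagonal-sumTo g (suc m) = cong (_+_ (g (suc m) 0)) (antidiagonal-sumTo (λ u f → g u (suc f)) m)


module ExplicitPowers (a b : ℕ) (C : Series) (isC : IsCatalanAB a b C) where
  open import Data.Nat as ℕ using (ℕ; zero; suc)
  open import Data.Integer as ℤ using (ℤ; +_; _+_; _*_; _^_)
  import Data.Integer.Properties as ℤ
  open import Data.Integer.Tactic.RingSolver using (solve-∀)
  open import Relation.Binary.PropositionalEquality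
  open LagrangeCoefficients using (M; viaP; viaQ; M-zero; M-suc)
  open Antidiagonals
  open Weights a b
  open CatalanPowers a b C isC

  weight : ℕ → ℕ → ℤ
  weight u f = q ^ u * p ^ f

  coefficient : ℕ → ℕ → ℤ
  coefficient m k = antidiagonal (λ u f → + M u f k * weight u f) m

  coefficient-suc : ∀ m k → coefficient (suc m) (suc k) ≡ coefficient (suc m) k + (p * coefficient m (suc k) + q * coefficient m (2 ℕ.+ k))
  coefficient-suc m k = begin
    coefficient (suc m) (suc k)
      ≡⟨ antidiagonal-cong (suc m) (λ u f u+f≡1+m → trans (cong (λ x → + x * weight u f) (M-suc m u f k u+f≡1+m)) (split u f)) ⟩
    antidiagonal (λ u f → term M u f + term viaP u f + term viaQ u f) (suc m)
      ≡⟨ antidiagonal-+ (λ u f → term M u f + term viaP u f) (term viaQ) (suc m) ⟩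
    antidiagonal (λ u f → term M u f + term viaP u f) (suc m) + antidiagonal (term viaQ) (suc m)
      ≡⟨ cong (_+ antidiagonal (term viaQ) (suc m)) (antidiagonal-+ (term M) (term viaP) (suc m)) ⟩
    coefficient (suc m) k + antidiagonal (term viaP) (suc m) + antidiagonal (term viaQ) (suc m)
      ≡⟨ ℤ.+-assoc (coefficient (suc m) k) _ _ ⟩
    coefficient (suc m) k + (antidiagonal (term viaP) (suc m) + antidiagonal (term viaQ) (suc m))
      ≡⟨ cong (_+_ (coefficient (suc m) k)) (cong₂ _+_ p-part q-part) ⟩
    coefficient (suc m) k + (p * coefficient m (suc k) + q * coefficient m (2 ℕ.+ k))
      ∎
    where
    open ≡-Reasoning
    term : (ℕ → ℕ → ℕ → ℕ) → ℕ → ℕ → ℤ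
    term c u f = + c u f k * weight u f
    split : ∀ u f → + (M u f k ℕ.+ viaP u f k ℕ.+ viaQ u f k) * weight u f ≡ term M u f + term viaP u f + term viaQ u f
    split u f = trans (cong (_* weight u f) (trans (ℤ.pos-+ (M u f k ℕ.+ viaP u f k) _) (cong (_+ + viaQ u f k) (ℤ.pos-+ (M u f k) _))))
                      (distrib (+ M u f k) (+ viaP u f k) (+ viaQ u f k) (weight u f))
      where
      distrib : ∀ x y z w → (x + y + z) * w ≡ x * w + y * w + z * w
      distrib = solve-∀
    p-part : antidiagonal (term viaP) (suc m) ≡ p * coefficient m (suc k)
    p-part = begin
      antidiagonal (term viaP) (suc m)
        ≡⟨ antidiagonal-suc-f (term viaP) m refl ⟩
      antidiagonal (λ u f → + M u f (suc k) * (q ^ u * (p * p ^ f))) m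
        ≡⟨ antidiagonal-cong m (λ u f _ → lemma p (q ^ u) (p ^ f) (+ M u f (suc k))) ⟩
      antidiagonal (λ u f → p * (+ M u f (suc k) * weight u f)) m
        ≡⟨ antidiagonal-scale p _ m ⟩
      p * coefficient m (suc k)
        ∎
      where
      lemma : ∀ p Q P x → x * (Q * (p * P)) ≡ p * (x * (Q * P))
      lemma = solve-∀
    q-part : antidiagonal (term viaQ) (suc m) ≡ q * coefficient m (2 ℕ.+ k)
    q-part = begin
      antidiagonal (term viaQ) (suc m)
        ≡⟨ antidiagonal-suc-u (term viaQ) m (λ _ → refl) ⟩
      antidiagonal (λ u f → + M u f (2 ℕ.+ k) * (q * q ^ u * p ^ f)) m
        ≡⟨ antidiagonal-cong m (λ u f _ → lemma q (q ^ u) (p ^ f) (+ M u f (2 ℕ.+ k))) ⟩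
      antidiagonal (λ u f → q * (+ M u f (2 ℕ.+ k) * weight u f)) m
        ≡⟨ antidiagonal-scale q _ m ⟩
      q * coefficient m (2 ℕ.+ k)
        ∎
      where
      lemma : ∀ q Q P x → x * (q * Q * P) ≡ q * (x * (Q * P))
      lemma = solve-∀

  P≡coefficient : ∀ m k → P k m ≡ coefficient m k
  P≡coefficient zero    k       = P-zero k
  P≡coefficient (suc m) zero    = sym (antidiagonal-zero _ (suc m) (λ u f e → cong (λ x → + x * weight u f) (M-zero m u f e)))
  P≡coefficient (suc m) (suc k) = begin
    P (suc k) (suc m)
      ≡⟨ P-suc k m ⟩
    P k (suc m) + (p * P (suc k) m + q * P (2 ℕ.+ k) m)
      ≡⟨ cong₂ (λ x y → P k (suc m) + (p * x + q * y)) (P≡coefficient m (suc k)) (P≡coefficient m (2 ℕ.+ k)) ⟩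
    P k (suc m) + (p * coefficient m (suc k) + q * coefficient m (2 ℕ.+ k))
      ≡⟨ cong (_+ (p * coefficient m (suc k) + q * coefficient m (2 ℕ.+ k))) (P≡coefficient (suc m) k) ⟩
    coefficient (suc m) k + (p * coefficient m (suc k) + q * coefficient m (2 ℕ.+ k))
      ≡⟨ coefficient-suc m k ⟨
    coefficient (suc m) (suc k)
      ∎
    where open ≡-Reasoning


module RationalSums where
  open import Data.Nat as ℕ using (ℕ; zero; suc; _<_)
  import Data.Nat.Properties as ℕ
  open import Data.Integer as ℤ using (ℤ; +_; _+_; _*_)
  import Data.Integer.Properties as ℤ
  open import Data.Integer.Tactic.RingSolver using (solve-∀)
  open import Data.Rational as ℚ using (ℚ; _/_)
  import Data.Rational.Properties as ℚ
  open import Data.Rational.Unnormalised using (mkℚᵘ; *≡*)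
  import Data.Rational.Unnormalised.Properties as ℚᵘ
  open import Data.List using (map; applyUpTo)
  open import Relation.Binary.PropositionalEquality

  toℚ-+ : ∀ x y → toℚ x ℚ.+ toℚ y ≡ toℚ (x + y)
  toℚ-+ x y = ℚ.toℚᵘ-injective
    (ℚᵘ.≃-trans (ℚ.toℚᵘ-homo-+ (x / 1) (y / 1))
    (ℚᵘ.≃-trans (ℚᵘ.+-cong (ℚ.toℚᵘ-fromℚᵘ (mkℚᵘ x 0)) (ℚ.toℚᵘ-fromℚᵘ (mkℚᵘ y 0)))
    (ℚᵘ.≃-trans (*≡* (lemma x y)) (ℚᵘ.≃-sym (ℚ.toℚᵘ-fromℚᵘ (mkℚᵘ (x + y) 0))))))
    where
    lemma : ∀ x y → (x * + 1 + y * + 1) * + 1 ≡ (x + y) * + 1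
    lemma = solve-∀

  /-*-toℚ : ∀ (x y z : ℤ) d → x * y ≡ + suc d * z → (x / suc d) ℚ.* toℚ y ≡ toℚ z
  /-*-toℚ x y z d eq = ℚ.toℚᵘ-injective
    (ℚᵘ.≃-trans (ℚ.toℚᵘ-homo-* (x / suc d) (y / 1))
    (ℚᵘ.≃-trans (ℚᵘ.*-cong (ℚ.toℚᵘ-fromℚᵘ (mkℚᵘ x d)) (ℚ.toℚᵘ-fromℚᵘ (mkℚᵘ y 0)))
    (ℚᵘ.≃-trans (*≡* cross) (ℚᵘ.≃-sym (ℚ.toℚᵘ-fromℚᵘ (mkℚᵘ z 0))))))
    where
    cross : x * y * + 1 ≡ z * + (suc d ℕ.* 1)
    cross = begin
      x * y * + 1          ≡⟨ ℤ.*-identityʳ (x * y) ⟩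
      x * y                ≡⟨ eq ⟩
      + suc d * z          ≡⟨ ℤ.*-comm (+ suc d) z ⟩
      z * + suc d          ≡⟨ cong (λ n → z * + n) (ℕ.*-identityʳ (suc d)) ⟨
      z * + (suc d ℕ.* 1)  ∎
      where open ≡-Reasoning

  sumℚ-toℚ : ∀ (F : ℕ → ℚ) (φ : ℕ → ℤ) ψ k → (∀ i → i < k → F (ψ i) ≡ toℚ (φ (ψ i))) →
    sumℚ (map F (applyUpTo ψ k)) ≡ toℚ (sumℤ (map φ (applyUpTo ψ k)))
  sumℚ-toℚ F φ ψ zero    e = refl
  sumℚ-toℚ F φ ψ (suc k) e =
    trans (cong₂ ℚ._+_ (e 0 (ℕ.s≤s ℕ.z≤n)) (sumℚ-toℚ F φ (λ i → ψ (suc i)) k (λ i i<k → e (suc i) (ℕ.s≤s i<k))))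
          (toℚ-+ (φ (ψ 0)) _)


module ClosedForm (a b : ℕ) where
  open LagrangeCoefficients using (M; M-binomial)
  open import Data.Nat as ℕ using (ℕ; suc; _≤_; _∸_)
  import Data.Nat.Properties as ℕ
  open import Data.Nat.Combinatorics using (_C_)
  import Data.Nat.Tactic.RingSolver as NS
  open import Data.Integer as ℤ using (ℤ; +_; _+_; _*_; _^_)
  import Data.Integer.Properties as ℤ
  open import Data.Integer.Tactic.RingSolver using (solve-∀)
  open import Data.Rational as ℚ using (_/_)
  import Data.Rational.Properties as ℚ
  open import Relation.Binary.PropositionalEquality
  open RationalSums
  open Weights a b

  summand : ℕ → ℕ → ℕ → ℤ
  summand n ℓ j = (p * + M ((n ∸ ℓ) ∸ j) j (2 ℕ.* (ℓ ℕ.+ 1)) + q * + M ((n ∸ ℓ) ∸ j) j (2 ℕ.* ℓ ℕ.+ 3)) * (p ^ j * q ^ (n ∸ j))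

  fraction-toℚ : ∀ c k d m u j P E → u ℕ.+ j ≡ m → suc d ≡ u ℕ.+ u ℕ.+ j ℕ.+ k →
    ((+ k * c * + (suc d C m)) / suc d) ℚ.* toℚ (+ (m C j) * P * E) ≡ toℚ (c * + M u j k * (P * E))
  fraction-toℚ c k d m u j P E refl eN = /-*-toℚ (+ k * c * + B₁) (+ B₂ * P * E) (c * + M u j k * (P * E)) d (begin
    + k * c * + B₁ * (+ B₂ * P * E)     ≡⟨ regroup₁ c (+ k) (+ B₁) (+ B₂) P E ⟩
    + k * + B₁ * + B₂ * c * (P * E)     ≡⟨ cong (λ x → x * c * (P * E)) (sym binomial) ⟩
    + suc d * + M u j k * c * (P * E)   ≡⟨ regroup₂ c (+ suc d) (+ M u j k) P E ⟩
    + suc d * (c * + M u j k * (P * E)) ∎)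
    where
    open ≡-Reasoning
    B₁ = suc d C m
    B₂ = m C j
    binomial : + suc d * + M u j k ≡ + k * + B₁ * + B₂
    binomial = begin
      + suc d * + M u j k        ≡⟨ ℤ.pos-* (suc d) (M u j k) ⟨
      + (suc d ℕ.* M u j k)      ≡⟨ cong +_ (M-binomial u j k (suc d) eN) ⟩
      + (k ℕ.* B₁ ℕ.* B₂)        ≡⟨ ℤ.pos-* (k ℕ.* B₁) B₂ ⟩
      + (k ℕ.* B₁) * + B₂        ≡⟨ cong (_* + B₂) (ℤ.pos-* k B₁) ⟩
      + k * + B₁ * + B₂          ∎
    regroup₁ : ∀ c K B₁ B₂ P E → K * c * B₁ * (B₂ * P * E) ≡ K * B₁ * B₂ * c * (P * E)
    regroup₁ = solve-∀
    regroup₂ : ∀ c N M P E → N * M * c * (P * E) ≡ N * (c * M * (P * E))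
    regroup₂ = solve-∀

  Uterm≡summand : ∀ n ℓ j → ℓ ≤ n → j ≤ n ∸ ℓ → Uterm a b n ℓ j ≡ toℚ (summand n ℓ j)
  Uterm≡summand n ℓ j ℓ≤n j≤m = begin
    (F₁ ℚ.+ F₂) ℚ.* toℚ Cz
      ≡⟨ ℚ.*-distribʳ-+ (toℚ Cz) F₁ F₂ ⟩
    F₁ ℚ.* toℚ Cz ℚ.+ F₂ ℚ.* toℚ Cz
      ≡⟨ cong₂ ℚ._+_ (fraction-toℚ p k₁ (suc (2 ℕ.* n ∸ j)) m u j (p ^ j) (q ^ (n ∸ j)) u+j≡m N₁-eq)
                     (fraction-toℚ q k₂ (suc (suc (2 ℕ.* n ∸ j))) m u j (p ^ j) (q ^ (n ∸ j)) u+j≡m N₂-eq) ⟩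
    toℚ (p * + M u j k₁ * w) ℚ.+ toℚ (q * + M u j k₂ * w)
      ≡⟨ toℚ-+ (p * + M u j k₁ * w) _ ⟩
    toℚ (p * + M u j k₁ * w + q * + M u j k₂ * w)
      ≡⟨ cong toℚ (sym (ℤ.*-distribʳ-+ w (p * + M u j k₁) (q * + M u j k₂))) ⟩
    toℚ (summand n ℓ j)
      ∎
    where
    open ≡-Reasoning
    m = n ∸ ℓ
    u = m ∸ j
    k₁ = 2 ℕ.* (ℓ ℕ.+ 1)
    k₂ = 2 ℕ.* ℓ ℕ.+ 3
    w = p ^ j * q ^ (n ∸ j)
    Cz = + (m C j) * p ^ j * q ^ (n ∸ j)
    F₁ = (+ k₁ * p * + (suc (suc (2 ℕ.* n ∸ j)) C m)) / suc (suc (2 ℕ.* n ∸ j))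
    F₂ = (+ k₂ * q * + (suc (suc (suc (2 ℕ.* n ∸ j))) C m)) / suc (suc (suc (2 ℕ.* n ∸ j)))
    u+j≡m : u ℕ.+ j ≡ m
    u+j≡m = ℕ.m∸n+n≡m j≤m
    n-split : n ≡ ℓ ℕ.+ (u ℕ.+ j)
    n-split = trans (sym (ℕ.m+[n∸m]≡n ℓ≤n)) (cong (ℓ ℕ.+_) (sym u+j≡m))
    -- 2n − j, computed without truncated subtraction
    2n∸j : 2 ℕ.* n ∸ j ≡ 2 ℕ.* ℓ ℕ.+ u ℕ.+ u ℕ.+ j
    2n∸j = trans (cong (λ n → 2 ℕ.* n ∸ j) n-split)
                 (trans (cong (_∸ j) (regroup ℓ u j)) (ℕ.m+n∸n≡m _ j))
      where
      regroup : ∀ ℓ u j → 2 ℕ.* (ℓ ℕ.+ (u ℕ.+ j)) ≡ (2 ℕ.* ℓ ℕ.+ u ℕ.+ u ℕ.+ j) ℕ.+ j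
      regroup = NS.solve-∀
    N₁-eq : suc (suc (2 ℕ.* n ∸ j)) ≡ u ℕ.+ u ℕ.+ j ℕ.+ k₁
    N₁-eq = trans (cong (λ x → suc (suc x)) 2n∸j) (regroup ℓ u j)
      where
      regroup : ∀ ℓ u j → suc (suc (2 ℕ.* ℓ ℕ.+ u ℕ.+ u ℕ.+ j)) ≡ u ℕ.+ u ℕ.+ j ℕ.+ 2 ℕ.* (ℓ ℕ.+ 1)
      regroup = NS.solve-∀
    N₂-eq : suc (suc (suc (2 ℕ.* n ∸ j))) ≡ u ℕ.+ u ℕ.+ j ℕ.+ k₂
    N₂-eq = trans (cong (λ x → suc (suc (suc x))) 2n∸j) (regroup ℓ u j)
      where
      regroup : ∀ ℓ u j → suc (suc (suc (2 ℕ.* ℓ ℕ.+ u ℕ.+ u ℕ.+ j))) ≡ u ℕ.+ u ℕ.+ j ℕ.+ (2 ℕ.* ℓ ℕ.+ 3)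
      regroup = NS.solve-∀


module ClosedFormOfUvalue (a b : ℕ) (C : Series) (isC : IsCatalanAB a b C) where
  open PowerSeries using (sumTo; sumTo-cong; sumℤ-applyUpTo)
  open LagrangeCoefficients using (M)
  open import Data.Nat as ℕ using (ℕ; suc; _∸_)
  import Data.Nat.Properties as ℕ
  import Data.Nat.Tactic.RingSolver as NS
  open import Data.Integer as ℤ using (ℤ; +_; _+_; _*_; _^_)
  import Data.Integer.Properties as ℤ
  open import Data.Integer.Tactic.RingSolver using (solve-∀)
  open import Data.List using (map; upTo)
  open import Relation.Binary.PropositionalEquality
  open Weights a b
  open CatalanPowers a b C isC using (P; Uvalue)
  open Antidiagonals
  open ExplicitPowers a b C isC using (coefficient; weight; P≡coefficient)
  open ClosedForm a b using (summand)

  Uvalue≡sum : ∀ n ℓ → ℓ ≤ n → Uvalue ℓ (n ∸ ℓ) ≡ sumℤ (map (summand n ℓ) (upTo (suc (n ∸ ℓ))))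
  Uvalue≡sum n ℓ ℓ≤n = begin
    q ^ ℓ * (p * P K₂ m + q * P K₃ m)
      ≡⟨ cong₂ (λ x y → q ^ ℓ * (p * x + q * y)) (P≡coefficient m K₂) (P≡coefficient m K₃) ⟩
    q ^ ℓ * (p * coefficient m K₂ + q * coefficient m K₃)
      ≡⟨ cong (λ x → q ^ ℓ * x) (cong₂ _+_ (antidiagonal-scale p (term K₂) m) (antidiagonal-scale q (term K₃) m)) ⟨
    q ^ ℓ * (antidiagonal (λ u f → p * term K₂ u f) m + antidiagonal (λ u f → q * term K₃ u f) m)
      ≡⟨ cong (λ x → q ^ ℓ * x) (antidiagonal-+ (λ u f → p * term K₂ u f) (λ u f → q * term K₃ u f) m) ⟨
    q ^ ℓ * antidiagonal (λ u f → p * term K₂ u f + q * term K₃ u f) m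
      ≡⟨ antidiagonal-scale (q ^ ℓ) _ m ⟨
    antidiagonal g m
      ≡⟨ antidiagonal-sumTo g m ⟩
    sumTo (λ f → g (m ∸ f) f) (suc m)
      ≡⟨ sumTo-cong (suc m) (λ f f<1+m → g≡summand f (ℕ.≤-pred f<1+m)) ⟩
    sumTo (summand n ℓ) (suc m)
      ≡⟨ sumℤ-applyUpTo (summand n ℓ) (λ i → i) (suc m) ⟨
    sumℤ (map (summand n ℓ) (upTo (suc m)))
      ∎
    where
    open ≡-Reasoning
    m = n ∸ ℓ
    K₂ = 2 ℕ.+ (ℓ ℕ.+ ℓ)
    K₃ = 3 ℕ.+ (ℓ ℕ.+ ℓ)
    term : ℕ → ℕ → ℕ → ℤ
    term k u f = + M u f k * weight u f
    g : ℕ → ℕ → ℤ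
    g u f = q ^ ℓ * (p * term K₂ u f + q * term K₃ u f)
    K₂-eq : ∀ ℓ → 2 ℕ.+ (ℓ ℕ.+ ℓ) ≡ 2 ℕ.* (ℓ ℕ.+ 1)
    K₂-eq = NS.solve-∀
    K₃-eq : ∀ ℓ → 3 ℕ.+ (ℓ ℕ.+ ℓ) ≡ 2 ℕ.* ℓ ℕ.+ 3
    K₃-eq = NS.solve-∀
    powers : ∀ f → f ≤ m → q ^ ℓ * q ^ (m ∸ f) ≡ q ^ (n ∸ f)
    powers f f≤m = trans (sym (ℤ.^-distribˡ-+-* q ℓ (m ∸ f)))
                         (cong (q ^_) (trans (sym (ℕ.+-∸-assoc ℓ f≤m)) (cong (_∸ f) (ℕ.m+[n∸m]≡n ℓ≤n))))
    regroup : ∀ p q Qℓ Qu Pf M₂ M₃ → Qℓ * (p * (M₂ * (Qu * Pf)) + q * (M₃ * (Qu * Pf))) ≡ (p * M₂ + q * M₃) * (Pf * (Qℓ * Qu))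
    regroup = solve-∀
    g≡summand : ∀ f → f ≤ m → g (m ∸ f) f ≡ summand n ℓ f
    g≡summand f f≤m =
      trans (regroup p q (q ^ ℓ) (q ^ (m ∸ f)) (p ^ f) (+ M (m ∸ f) f K₂) (+ M (m ∸ f) f K₃))
            (cong₂ (λ x y → x * (p ^ f * y))
                   (cong₂ (λ k k′ → p * + M (m ∸ f) f k + q * + M (m ∸ f) f k′) (K₂-eq ℓ) (K₃-eq ℓ))
                   (powers f f≤m))


module CatalanSeries (a b : ℕ) where
  open PowerSeries
  open import Data.Nat as ℕ using (ℕ; zero; suc; _≤_; _≤?_; z≤n)
  import Data.Nat.Properties as ℕ
  open import Data.Integer as ℤ using (ℤ; +_; _+_; _*_)
  import Data.Integer.Properties as ℤ
  open import Data.Empty using (⊥-elim)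
  open import Relation.Nullary using (yes; no)
  open import Relation.Binary.PropositionalEquality
  open Weights a b

  -- approximation n has the correct coefficients up to x^n; the next one is read off the functional equation
  approximation : ℕ → Series
  approximation zero    = oneS
  approximation (suc n) i with i ≤? n
  ... | yes _ = approximation n i
  ... | no  _ = p * approximation n n + q * (approximation n ⋆ approximation n) n

  catalan : Series
  catalan i = approximation i i

  catalan-suc : ∀ n → catalan (suc n) ≡ p * approximation n n + q * (approximation n ⋆ approximation n) n
  catalan-suc n with suc n ≤? n
  ... | yes 1+n≤n = ⊥-elim (ℕ.<-irrefl refl 1+n≤n)
  ... | no  _     = refl

  approximation-correct : ∀ n i → i ≤ n → approximation n i ≡ catalan i
  approximation-correct zero    zero    z≤n = refl
  approximation-correct (suc n) i       i≤1+n with i ≤? n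
  ... | yes i≤n = approximation-correct n i i≤n
  ... | no  i≰n = trans (sym (catalan-suc n)) (cong catalan (sym (ℕ.≤-antisym i≤1+n (ℕ.≰⇒> i≰n))))

  isCatalan : IsCatalanAB a b catalan
  isCatalan zero    = sym (cong (_+_ (+ 1)) (cong₂ _+_ (trans (cong (p *_) (xS⊛≗shift catalan 0)) (ℤ.*-zeroʳ p))
                                                     (trans (cong (q *_) (xS⊛≗shift (catalan ⊛ catalan) 0)) (ℤ.*-zeroʳ q))))
  isCatalan (suc n) = begin
    catalan (suc n)
      ≡⟨ catalan-suc n ⟩
    p * approximation n n + q * (approximation n ⋆ approximation n) n
      ≡⟨ cong₂ (λ x y → p * x + q * y) (approximation-correct n n ℕ.≤-refl)
               (⋆-local _ _ _ _ n (approximation-correct n) (approximation-correct n)) ⟩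
    p * catalan n + q * (catalan ⋆ catalan) n
      ≡⟨ cong₂ (λ x y → p * x + q * y) (xS⊛≗shift catalan (suc n))
               (trans (xS⊛≗shift (catalan ⊛ catalan) (suc n)) (⊛≗⋆ catalan catalan n)) ⟨
    p * (xS ⊛ catalan) (suc n) + q * (xS ⊛ (catalan ⊛ catalan)) (suc n)
      ≡⟨ ℤ.+-identityˡ _ ⟨
    (oneS ⊕ (scale p (xS ⊛ catalan) ⊕ scale q (xS ⊛ (catalan ⊛ catalan)))) (suc n)
      ∎
    where open ≡-Reasoning


open import Data.Nat as ℕ using (suc; z≤n; _∸_)
import Data.Nat.Properties as ℕ
open import Data.Integer as ℤ using (_+_; _*_; _-_)
import Data.Integer.Properties as ℤ
open import Data.Integer.Tactic.RingSolver using (solve-∀)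
open import Data.List using (map; upTo)
open import Data.Product using (_,_)
open import Relation.Binary.PropositionalEquality using (cong; cong₂; sym; trans; module ≡-Reasoning)
open RationalSums using (sumℚ-toℚ)

theorem7p2 : (a b : ℕ) → 1 ≤ a → 1 ≤ b →
    ((n ℓ : ℕ) → ℓ ≤ n → (+ Ucount a b n ℓ) / 1 ≡ Uformula a b n ℓ)
    × (Ucount a b 0 0 ≡ a)
    × ((C : Series) → IsCatalanAB a b C → (n ℓ : ℕ) → ℓ ≤ n →
        + Ucount a b n ℓ ≡ riordanEntry (riordanD a b C) (riordanH a b C) n ℓ)
theorem7p2 a b _ _ = closed-form , first-value , riordan
  where
  open ≡-Reasoning
  open Weights a b
  open CatalanSeries a b using (catalan; isCatalan)
  open CatalanPowers a b catalan isCatalan using (Uvalue; P-zero)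
  open Counting a b catalan isCatalan using (Ucount≡Uvalue)
  open ClosedForm a b using (summand; Uterm≡summand)
  open ClosedFormOfUvalue a b catalan isCatalan using (Uvalue≡sum)

  closed-form : (n ℓ : ℕ) → ℓ ≤ n → (+ Ucount a b n ℓ) / 1 ≡ Uformula a b n ℓ
  closed-form n ℓ ℓ≤n = begin
    toℚ (+ Ucount a b n ℓ)                               ≡⟨ cong toℚ (trans (Ucount≡Uvalue ℓ≤n) (Uvalue≡sum n ℓ ℓ≤n)) ⟩
    toℚ (sumℤ (map (summand n ℓ) (upTo (suc (n ∸ ℓ))))) ≡⟨ sumℚ-toℚ (Uterm a b n ℓ) (summand n ℓ) (λ i → i) (suc (n ∸ ℓ))
                                                              (λ j j<1+m → Uterm≡summand n ℓ j ℓ≤n (ℕ.≤-pred j<1+m)) ⟨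
    Uformula a b n ℓ                                     ∎

  first-value : Ucount a b 0 0 ≡ a
  first-value = ℤ.+-injective (begin
    + Ucount a b 0 0                      ≡⟨ Ucount≡Uvalue {0} {0} z≤n ⟩
    Uvalue 0 0                            ≡⟨ cong₂ (λ x y → + 1 * (p * x + q * y)) (P-zero 2) (P-zero 3) ⟩
    + 1 * ((+ a - + b) * + 1 + + b * + 1) ≡⟨ p+q≡a (+ a) (+ b) ⟩
    + a                                   ∎)
    where
    p+q≡a : ∀ A B → + 1 * ((A - B) * + 1 + B * + 1) ≡ A
    p+q≡a = solve-∀

  riordan : (C : Series) → IsCatalanAB a b C → (n ℓ : ℕ) → ℓ ≤ n →
    + Ucount a b n ℓ ≡ riordanEntry (riordanD a b C) (riordanH a b C) n ℓ
  riordan C isC n ℓ ℓ≤n =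
    trans (Counting.Ucount≡Uvalue a b C isC ℓ≤n) (sym (CatalanPowers.riordanEntry≡Uvalue a b C isC ℓ≤n))
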